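{- Let $G_1$ and $G_2$ be graphs with $n_1$ and $n_2$ vertices respectively, let $t$ be a positive integer, and let $G$ be a $t$-connected sum of $G_1$ and $G_2$. Then for every nonnegative integer $k$, $$c_k(G)=\sum_{i=0}^k\left(c_i(G_1)\binom{n_2-t}{k-i}+c_i(G_2)\binom{n_1-t}{k-i}\right)-\binom{n_1+n_2-t}{k}+\binom{n_1+n_2-2t}{k}.$$
   Context: All graphs are simple. For a graph $G$ with vertex set $V$ and $W\subset V$, $G|_W$ is the induced subgraph on $W$, and $\mathrm{nc}(G|_W)$ is its number of connected components (so $\mathrm{nc}(G|_\emptyset)=0$). Define $c_k(G)=\sum_{W\subset V,\,|W|=k}\mathrm{nc}(G|_W)$. Connected sum of graphs: let $G_1,G_2$ be graphs with vertex sets $V_1,V_2$ and edge sets $E_1,E_2$; let $F_1\subset V_1$, $F_2\subset V_2$ with $|F_1|=|F_2|=t$ such that $G_1|_{F_1}$ and $G_2|_{F_2}$ are complete graphs; let $\sigma:V_2\to V_2'$ be a bijection onto a finite set $V_2'$ with $V_1\cap V_2'=F_1$ and $\sigma(F_2)=F_1$. The graph with vertex set $V_1\cup V_2'$ and edge set $E_1\cup\{\{\sigma(x),\sigma(y)\}:\{x,y\}\in E_2\}$ is called a $t$-connected sum of $G_1$ and $G_2$. -}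

module Defs where

open import Data.Bool using (Bool; true; false; _∧_; _∨_; not)
open import Data.Nat using (ℕ; zero; suc; _+_; _<ᵇ_; _≡ᵇ_)
open import Data.Fin using (Fin; toℕ)
open import Data.Fin.Subset using (Subset; _∈_; ∣_∣)
open import Data.Vec using (Vec; []; _∷_; lookup)
open import Data.List using (List; []; _∷_; map; _++_; allFin; filterᵇ; length)
open import Data.Bool.ListAction using (any)
open import Data.Nat.ListAction using (sum)
open import Data.Product using (Σ; ∃; _×_)
open import Data.Sum using (_⊎_)
open import Relation.Nullary using (¬_)
open import Relation.Nullary.Decidable using (⌊_⌋)
open import Relation.Binary.PropositionalEquality using (_≡_; _≢_)
import Data.Fin as F

record Graph (n : ℕ) : Set where
  field
    adj    : Fin n → Fin n → Bool
    adj-sym : ∀ u v → adj u v ≡ adj v u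
    adj-irrefl : ∀ u → adj u u ≡ false
open Graph public

-- reach G W s u v : there is a walk of length ≤ s from u to v with all vertices in W
reach : ∀ {n} → Graph n → Subset n → ℕ → Fin n → Fin n → Bool
reach G W zero u v = lookup W u ∧ ⌊ u F.≟ v ⌋
reach {n} G W (suc s) u v =
  reach G W s u v ∨ any (λ w → reach G W s u w ∧ (adj G w v ∧ lookup W v)) (allFin n)

-- u and v lie in the same connected component of G|_W (walks of length ≤ n suffice)
connIn : ∀ {n} → Graph n → Subset n → Fin n → Fin n → Bool
connIn {n} G W u v = reach G W n u v

-- nc(G|_W): number of connected components of the induced subgraph G|_W,
-- counted as the number of vertices of W which are the least vertex of their component.
nc : ∀ {n} → Graph n → Subset n → ℕ
nc {n} G W = length (filterᵇ isRep (allFin n))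
  where
  isRep : Fin n → Bool
  isRep v = lookup W v ∧
            not (any (λ u → (toℕ u <ᵇ toℕ v) ∧ connIn G W u v) (allFin n))

subsets : ∀ n → List (Subset n)
subsets zero = [] ∷ []
subsets (suc n) = map (true ∷_) (subsets n) ++ map (false ∷_) (subsets n)

c : ∀ {n} → ℕ → Graph n → ℕ
c {n} k G = sum (map (nc G) (filterᵇ (λ W → ∣ W ∣ ≡ᵇ k) (subsets n)))

IsClique : ∀ {n} → Graph n → Subset n → Set
IsClique G F = ∀ x y → x ∈ F → y ∈ F → x ≢ y → adj G x y ≡ true

-- The vertex set V₁ ∪ V₂' of the definition is identified with Fin m; ι₁ : V₁ ↪ Fin m is
-- the inclusion of V₁ and ι₂ : V₂ ↪ Fin m is σ (followed by inclusion).
record IsConnectedSum (t : ℕ) {n₁ n₂ m : ℕ}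
       (G₁ : Graph n₁) (G₂ : Graph n₂) (G : Graph m) : Set where
  field
    F₁ : Subset n₁
    F₂ : Subset n₂
    ∣F₁∣ : ∣ F₁ ∣ ≡ t
    ∣F₂∣ : ∣ F₂ ∣ ≡ t
    F₁-clique : IsClique G₁ F₁
    F₂-clique : IsClique G₂ F₂
    ι₁ : Fin n₁ → Fin m
    ι₂ : Fin n₂ → Fin m
    ι₁-inj : ∀ x y → ι₁ x ≡ ι₁ y → x ≡ y
    ι₂-inj : ∀ x y → ι₂ x ≡ ι₂ y → x ≡ y
    -- V = V₁ ∪ V₂'
    cover : ∀ v → (∃ λ x → ι₁ x ≡ v) ⊎ (∃ λ y → ι₂ y ≡ v)
    -- V₁ ∩ V₂' = F₁
    inter⊆F₁ : ∀ x y → ι₁ x ≡ ι₂ y → x ∈ F₁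
    F₁⊆V₂'  : ∀ x → x ∈ F₁ → ∃ λ y → ι₂ y ≡ ι₁ x
    -- σ(F₂) = F₁
    σF₂⊆F₁ : ∀ y → y ∈ F₂ → ∃ λ x → x ∈ F₁ × ι₁ x ≡ ι₂ y
    F₁⊆σF₂ : ∀ x → x ∈ F₁ → ∃ λ y → y ∈ F₂ × ι₂ y ≡ ι₁ x
    -- E = E₁ ∪ σ(E₂)
    edges : ∀ u v → adj G u v ≡ true →
            (∃ λ a → ∃ λ b → ι₁ a ≡ u × ι₁ b ≡ v × adj G₁ a b ≡ true) ⊎
            (∃ λ a → ∃ λ b → ι₂ a ≡ u × ι₂ b ≡ v × adj G₂ a b ≡ true)
    edges₁ : ∀ a b → adj G₁ a b ≡ true → adj G (ι₁ a) (ι₁ b) ≡ true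
    edges₂ : ∀ a b → adj G₂ a b ≡ true → adj G (ι₂ a) (ι₂ b) ≡ true

module Submission where

-- Let G be glued from G₁ and G₂ along the clique F = V₁ ∩ V₂' (|F| = t), and for
-- W ⊆ V write Wᵢ = W ∩ Vᵢ, read as a vertex set of Gᵢ.  The heart of the proof is the
-- pointwise identity
--     nc(G|_W) + [W ∩ F ≠ ∅] = nc(G₁|_W₁) + nc(G₂|_W₂),                    (★)
-- proved by matching components: a component of G|_W meets V₁ in at most one
-- component of G₁|_W₁, since a walk leaving V₁ can only re-enter through the clique F;
-- it meets V₁ or V₂, and meets both iff it meets F; and all of W ∩ F lies in a single
-- component.  Summing (★) over the k-subsets W of V (m = n₁ + n₂ − t vertices) gives
--     c_k(G) + C(m, k) − C(m − t, k) = Σ_{|W|=k} (nc(G₁|_W₁) + nc(G₂|_W₂)),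
-- and Σ_{|W|=k} nc(G₁|_W₁) = Σ_i c_i(G₁) C(n₂ − t, k − i) because every i-subset of V₁
-- has exactly C(m − n₁, k − i) extensions to a k-subset of V.

open import Defs
open import Data.Bool using (Bool; true; false; _∧_; _∨_; not)
import Data.Bool as Bool
open import Data.Bool.Properties using (T-≡; ∧-comm; ∨-comm; ∧-zeroʳ; ∧-identityʳ)
open import Data.Bool.ListAction using (any)
open import Data.Nat using (ℕ; zero; suc; _+_; _*_; _∸_; _≤_; _<_; z≤n; s≤s; _≡ᵇ_; _<ᵇ_; _≤ᵇ_)
import Data.Nat.Properties as ℕₚ
open import Data.Nat.Properties using (+-*-semiring; +-comm; *-comm; *-zeroʳ; +-identityʳ; *-identityʳ)
open import Data.Nat.Combinatorics using (_C_; nCk+nC[k+1]≡[n+1]C[k+1])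
open import Data.Nat.ListAction using (sum)
open import Data.Nat.ListAction.Properties using (sum-++)
open import Data.Nat.Tactic.RingSolver using (solve-∀)
open import Data.Fin using (Fin; zero; suc; toℕ)
import Data.Fin as Fin
import Data.Fin.Properties as Finₚ
open import Data.Fin.Subset using (Subset; ∣_∣; _∈_; _∩_; ⊤) renaming (⊥ to ∅)
open import Data.Fin.Subset.Properties using (∣⊤∣≡n)
open import Data.Vec using ([]; _∷_; lookup; tabulate)
import Data.Vec.Properties as Vecₚ
open import Data.List using (List; []; _∷_; map; _++_; allFin; filterᵇ; length; upTo; applyUpTo)
import Data.List as List
import Data.List.Properties as Listₚ
open import Data.List.Relation.Unary.Any using (satisfied)
open import Data.List.Relation.Unary.Any.Properties using (any⁺; any⁻)
open import Data.List.Membership.Propositional using (lose)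
open import Data.List.Membership.Propositional.Properties using (∈-allFin)
open import Data.Product using (∃; _×_; _,_; proj₁; proj₂)
open import Data.Sum using (_⊎_; inj₁; inj₂) renaming (swap to ⊎-swap)
open import Data.Empty using (⊥; ⊥-elim)
open import Relation.Nullary using (¬_; Dec; yes; no)
open import Relation.Nullary.Decidable using (⌊_⌋)
open import Relation.Binary.Definitions using (tri<; tri≈; tri>)
open import Relation.Binary.PropositionalEquality
  using (_≡_; _≢_; refl; sym; trans; cong; cong₂; subst; subst₂; module ≡-Reasoning)
open import Function using (_∘_; Equivalence)
open import Algebra.Properties.Semiring.Sum +-*-semiring
  using (sum-syntax; sum-cong-≗; sum-replicate-zero; ∑-distrib-+; ∑-comm; *-distribˡ-sum; *-distribʳ-sum)
open import Algebra.Properties.CommutativeSemigroup ℕₚ.+-commutativeSemigroup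
  using () renaming (interchange to +-interchange)

open ≡-Reasoning
open Equivalence using (to; from)

𝟙 : Bool → ℕ
𝟙 true = 1
𝟙 false = 0

𝟙-∧ : ∀ a b → 𝟙 (a ∧ b) ≡ 𝟙 a * 𝟙 b
𝟙-∧ true b = sym (+-identityʳ (𝟙 b))
𝟙-∧ false b = refl

𝟙-∨ : ∀ a b → a ∨ b ≡ true → 𝟙 a + 𝟙 b ≡ 1 + 𝟙 (a ∧ b)
𝟙-∨ true true _ = refl
𝟙-∨ true false _ = refl
𝟙-∨ false true _ = refl

𝟙-split : ∀ x a b → x * a + x ≡ x * (a + 𝟙 b) + x * 𝟙 (not b)
𝟙-split x a true = split-true x a
  where
  split-true : ∀ x a → x * a + x ≡ x * (a + 1) + x * 0
  split-true = solve-∀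
𝟙-split x a false = split-false x a
  where
  split-false : ∀ x a → x * a + x ≡ x * (a + 0) + x * 1
  split-false = solve-∀

𝟙-≤1 : ∀ b → 𝟙 b ≤ 1
𝟙-≤1 true = s≤s z≤n
𝟙-≤1 false = z≤n

𝟙-mono : ∀ {a b} → (a ≡ true → b ≡ true) → 𝟙 a ≤ 𝟙 b
𝟙-mono {false} _ = z≤n
𝟙-mono {true} a⇒b rewrite a⇒b refl = ℕₚ.≤-refl

∧-elim : ∀ {a b} → a ∧ b ≡ true → a ≡ true × b ≡ true
∧-elim {true} {true} _ = refl , refl

∧-intro : ∀ {a b} → a ≡ true → b ≡ true → a ∧ b ≡ true
∧-intro refl refl = refl

∨-elim : ∀ {a b} → a ∨ b ≡ true → a ≡ true ⊎ b ≡ true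
∨-elim {true} _ = inj₁ refl
∨-elim {false} e = inj₂ e

∨-introˡ : ∀ {a} b → a ≡ true → a ∨ b ≡ true
∨-introˡ b refl = refl

∨-introʳ : ∀ a {b} → b ≡ true → a ∨ b ≡ true
∨-introʳ true _ = refl
∨-introʳ false e = e

∨-resolveˡ : ∀ {a b} → a ≡ false → a ∨ b ≡ true → b ≡ true
∨-resolveˡ refl e = e

not≡true : ∀ {b} → not b ≡ true → b ≡ false
not≡true {false} _ = refl

not≡false : ∀ {b} → not b ≡ false → b ≡ true
not≡false {true} _ = refl

true≢false : ∀ {a} → a ≡ true → a ≡ false → ⊥
true≢false refl ()

not-true⇒false : ∀ {a} → ¬ a ≡ true → a ≡ false
not-true⇒false {true} ¬a = ⊥-elim (¬a refl)
not-true⇒false {false} _ = refl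

bool-ext : ∀ {a b} → (a ≡ true → b ≡ true) → (b ≡ true → a ≡ true) → a ≡ b
bool-ext {true} a⇒b _ = sym (a⇒b refl)
bool-ext {false} {true} _ b⇒a = b⇒a refl
bool-ext {false} {false} _ _ = refl

≤ᵇ-suc : ∀ s k → (suc s ≤ᵇ suc k) ≡ (s ≤ᵇ k)
≤ᵇ-suc zero k = refl
≤ᵇ-suc (suc s) k = refl

≡ᵇ-split : ∀ s d k → 𝟙 (s + d ≡ᵇ k) ≡ 𝟙 (s ≤ᵇ k) * 𝟙 (d ≡ᵇ k ∸ s)
≡ᵇ-split zero d k = sym (+-identityʳ _)
≡ᵇ-split (suc s) d zero = refl
≡ᵇ-split (suc s) d (suc k) = trans (≡ᵇ-split s d k) (cong (λ b → 𝟙 b * 𝟙 (d ≡ᵇ k ∸ s)) (sym (≤ᵇ-suc s k)))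

⌊⌋-sound : ∀ {P : Set} (d : Dec P) → ⌊ d ⌋ ≡ true → P
⌊⌋-sound (yes p) _ = p

⌊⌋-complete : ∀ {P : Set} (d : Dec P) → P → ⌊ d ⌋ ≡ true
⌊⌋-complete (yes _) _ = refl
⌊⌋-complete (no ¬p) p = ⊥-elim (¬p p)

⌊⌋-false : ∀ {P : Set} (d : Dec P) → ¬ P → ⌊ d ⌋ ≡ false
⌊⌋-false (yes p) ¬p = ⊥-elim (¬p p)
⌊⌋-false (no _) _ = refl

anyᶠ : ∀ {n} → (Fin n → Bool) → Bool
anyᶠ {n} p = any p (allFin n)

allᶠ : ∀ {n} → (Fin n → Bool) → Bool
allᶠ {zero} p = true
allᶠ {suc n} p = p zero ∧ allᶠ (p ∘ suc)

anyᶠ-intro : ∀ {n} (p : Fin n → Bool) i → p i ≡ true → anyᶠ p ≡ true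
anyᶠ-intro p i pi = to T-≡ (any⁺ p (lose (∈-allFin i) (from T-≡ pi)))

anyᶠ-elim : ∀ {n} (p : Fin n → Bool) → anyᶠ p ≡ true → ∃ λ i → p i ≡ true
anyᶠ-elim {n} p e with satisfied (any⁻ p (allFin n) (from T-≡ e))
... | i , pi = i , to T-≡ pi

anyᶠ-false : ∀ {n} (p : Fin n → Bool) → anyᶠ p ≡ false → ∀ i → p i ≡ false
anyᶠ-false p none i = not-true⇒false (λ pi → true≢false (anyᶠ-intro p i pi) none)

allᶠ-elim : ∀ {n} (p : Fin n → Bool) → allᶠ p ≡ true → ∀ i → p i ≡ true
allᶠ-elim {suc n} p e zero = proj₁ (∧-elim e)
allᶠ-elim {suc n} p e (suc i) = allᶠ-elim (p ∘ suc) (proj₂ (∧-elim {p zero} e)) i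

allᶠ-intro : ∀ {n} (p : Fin n → Bool) → (∀ i → p i ≡ true) → allᶠ p ≡ true
allᶠ-intro {zero} p _ = refl
allᶠ-intro {suc n} p all = ∧-intro (all zero) (allᶠ-intro (p ∘ suc) (all ∘ suc))

∑-zero : ∀ n {f : Fin n → ℕ} → (∀ i → f i ≡ 0) → ∑[ i < n ] f i ≡ 0
∑-zero n f≡0 = trans (sum-cong-≗ f≡0) (sum-replicate-zero n)

∑-ones : ∀ n → ∑[ i < n ] 1 ≡ n
∑-ones zero = refl
∑-ones (suc n) = cong suc (∑-ones n)

∑-single : ∀ n (f : Fin n → ℕ) a → (∀ i → i ≢ a → f i ≡ 0) → ∑[ i < n ] f i ≡ f a
∑-single (suc n) f zero off =
  trans (cong (f zero +_) (∑-zero n (λ i → off (suc i) λ ()))) (+-identityʳ (f zero))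
∑-single (suc n) f (suc a) off =
  cong₂ _+_ (off zero λ ()) (∑-single n (f ∘ suc) a (λ i i≢a → off (suc i) (i≢a ∘ Finₚ.suc-injective)))

∑-mono : ∀ n (f g : Fin n → ℕ) → (∀ i → f i ≤ g i) → ∑[ i < n ] f i ≤ ∑[ i < n ] g i
∑-mono zero f g _ = z≤n
∑-mono (suc n) f g f≤g = ℕₚ.+-mono-≤ (f≤g zero) (∑-mono n (f ∘ suc) (g ∘ suc) (f≤g ∘ suc))

term≤∑ : ∀ n (f : Fin n → ℕ) a → f a ≤ ∑[ i < n ] f i
term≤∑ (suc n) f zero = ℕₚ.m≤m+n _ _
term≤∑ (suc n) f (suc a) = ℕₚ.≤-trans (term≤∑ n (f ∘ suc) a) (ℕₚ.m≤n+m _ _)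

#[_] : ∀ {n} → (Fin n → Bool) → ℕ
#[_] {n} p = ∑[ i < n ] 𝟙 (p i)

#-≤ : ∀ n (p : Fin n → Bool) → #[ p ] ≤ n
#-≤ n p = subst (#[ p ] ≤_) (∑-ones n) (∑-mono n _ _ (𝟙-≤1 ∘ p))

#-complement : ∀ n (p : Fin n → Bool) → #[ p ] + #[ not ∘ p ] ≡ n
#-complement n p = begin
  #[ p ] + #[ not ∘ p ]                 ≡⟨ ∑-distrib-+ (𝟙 ∘ p) (𝟙 ∘ not ∘ p) ⟨
  ∑[ i < n ] (𝟙 (p i) + 𝟙 (not (p i)))  ≡⟨ sum-cong-≗ (λ i → one (p i)) ⟩
  ∑[ i < n ] 1                          ≡⟨ ∑-ones n ⟩
  n                                     ∎
  where
  one : ∀ b → 𝟙 b + 𝟙 (not b) ≡ 1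
  one true = refl
  one false = refl

#-at-most-one : ∀ n (p : Fin n → Bool) → (∀ i j → p i ≡ true → p j ≡ true → i ≡ j) →
  #[ p ] ≡ 𝟙 (anyᶠ p)
#-at-most-one n p unique with anyᶠ p in e
... | false = ∑-zero n (λ i → cong 𝟙 (anyᶠ-false p e i))
... | true with anyᶠ-elim p e
...   | a , pa = trans (∑-single n (𝟙 ∘ p) a (λ i i≢a → cong 𝟙 (not-true⇒false (λ pi → i≢a (unique i a pi pa)))))
                       (cong 𝟙 pa)

#-⊆-antisym : ∀ n (p q : Fin n → Bool) → (∀ i → p i ≡ true → q i ≡ true) →
  #[ q ] ≤ #[ p ] → ∀ i → q i ≡ true → p i ≡ true
#-⊆-antisym (suc n) p q p⊆q q≤p zero q0 = head∈p (p zero) refl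
  where
  head∈p : ∀ b → p zero ≡ b → p zero ≡ true
  head∈p true e = e
  head∈p false e = ⊥-elim (ℕₚ.<⇒≱ p<q q≤p)
    where
    p<q : #[ p ] < #[ q ]
    p<q rewrite e | q0 = s≤s (∑-mono n _ _ (λ i → 𝟙-mono (p⊆q (suc i))))
#-⊆-antisym (suc n) p q p⊆q q≤p (suc i) qi =
  #-⊆-antisym n (p ∘ suc) (q ∘ suc) (p⊆q ∘ suc) tail-≤ i qi
  where
  tail-≤ : #[ q ∘ suc ] ≤ #[ p ∘ suc ]
  tail-≤ = ℕₚ.+-cancelˡ-≤ (𝟙 (p zero)) _ _
             (ℕₚ.≤-trans (ℕₚ.+-monoˡ-≤ _ (𝟙-mono (p⊆q zero))) q≤p)

∑ˢ : ∀ m → (Subset m → ℕ) → ℕ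
∑ˢ zero f = f []
∑ˢ (suc m) f = ∑ˢ m (λ W → f (true ∷ W)) + ∑ˢ m (λ W → f (false ∷ W))

∑ˢ-cong : ∀ m {f g : Subset m → ℕ} → (∀ W → f W ≡ g W) → ∑ˢ m f ≡ ∑ˢ m g
∑ˢ-cong zero f≡g = f≡g []
∑ˢ-cong (suc m) f≡g = cong₂ _+_ (∑ˢ-cong m (f≡g ∘ (true ∷_))) (∑ˢ-cong m (f≡g ∘ (false ∷_)))

∑ˢ-zero : ∀ m (f : Subset m → ℕ) → (∀ W → f W ≡ 0) → ∑ˢ m f ≡ 0
∑ˢ-zero zero f f≡0 = f≡0 []
∑ˢ-zero (suc m) f f≡0 = cong₂ _+_ (∑ˢ-zero m _ (f≡0 ∘ (true ∷_))) (∑ˢ-zero m _ (f≡0 ∘ (false ∷_)))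

∑ˢ-0 : ∀ m → ∑ˢ m (λ _ → 0) ≡ 0
∑ˢ-0 m = ∑ˢ-zero m (λ _ → 0) (λ _ → refl)

∑ˢ-+ : ∀ m (f g : Subset m → ℕ) → ∑ˢ m (λ W → f W + g W) ≡ ∑ˢ m f + ∑ˢ m g
∑ˢ-+ zero f g = refl
∑ˢ-+ (suc m) f g =
  trans (cong₂ _+_ (∑ˢ-+ m (f ∘ (true ∷_)) (g ∘ (true ∷_))) (∑ˢ-+ m (f ∘ (false ∷_)) (g ∘ (false ∷_))))
        (+-interchange (∑ˢ m (f ∘ (true ∷_))) (∑ˢ m (g ∘ (true ∷_))) (∑ˢ m (f ∘ (false ∷_))) (∑ˢ m (g ∘ (false ∷_))))

∑ˢ-*ˡ : ∀ m x (f : Subset m → ℕ) → ∑ˢ m (λ W → x * f W) ≡ x * ∑ˢ m f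
∑ˢ-*ˡ zero x f = refl
∑ˢ-*ˡ (suc m) x f = trans (cong₂ _+_ (∑ˢ-*ˡ m x _) (∑ˢ-*ˡ m x _)) (sym (ℕₚ.*-distribˡ-+ x _ _))

∑ˢ-comm : ∀ m a (f : Subset m → Subset a → ℕ) →
  ∑ˢ m (λ W → ∑ˢ a (λ U → f W U)) ≡ ∑ˢ a (λ U → ∑ˢ m (λ W → f W U))
∑ˢ-comm zero a f = refl
∑ˢ-comm (suc m) a f = trans (cong₂ _+_ (∑ˢ-comm m a _) (∑ˢ-comm m a _)) (sym (∑ˢ-+ a _ _))

∑ˢ-subsets : ∀ m (f : Subset m → ℕ) → sum (map f (subsets m)) ≡ ∑ˢ m f
∑ˢ-subsets zero f = +-identityʳ (f [])
∑ˢ-subsets (suc m) f = begin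
  sum (map f (map (true ∷_) (subsets m) ++ map (false ∷_) (subsets m)))
    ≡⟨ cong sum (Listₚ.map-++ f (map (true ∷_) (subsets m)) _) ⟩
  sum (map f (map (true ∷_) (subsets m)) ++ map f (map (false ∷_) (subsets m)))
    ≡⟨ sum-++ (map f (map (true ∷_) (subsets m))) _ ⟩
  sum (map f (map (true ∷_) (subsets m))) + sum (map f (map (false ∷_) (subsets m)))
    ≡⟨ cong₂ _+_ (cong sum (sym (Listₚ.map-∘ (subsets m)))) (cong sum (sym (Listₚ.map-∘ (subsets m)))) ⟩
  sum (map (f ∘ (true ∷_)) (subsets m)) + sum (map (f ∘ (false ∷_)) (subsets m))
    ≡⟨ cong₂ _+_ (∑ˢ-subsets m _) (∑ˢ-subsets m _) ⟩
  ∑ˢ (suc m) f ∎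

sum-filter : ∀ {A : Set} (p : A → Bool) (f : A → ℕ) (xs : List A) →
  sum (map f (filterᵇ p xs)) ≡ sum (map (λ x → 𝟙 (p x) * f x) xs)
sum-filter p f [] = refl
sum-filter p f (x ∷ xs) with p x
... | true = cong₂ _+_ (sym (+-identityʳ (f x))) (sum-filter p f xs)
... | false = sum-filter p f xs

c-as-∑ˢ : ∀ {m} k (G : Graph m) → c k G ≡ ∑ˢ m (λ W → 𝟙 (∣ W ∣ ≡ᵇ k) * nc G W)
c-as-∑ˢ {m} k G = trans (sum-filter _ (nc G) (subsets m)) (∑ˢ-subsets m _)

_⋆_ : (ℕ → ℕ) → (ℕ → ℕ) → ℕ → ℕ
(f ⋆ g) k = sum (applyUpTo (λ i → f i * g (k ∸ i)) (suc k))

-- Definitionally (f ⋆ g) (suc k) = f 0 · g (suc k) + ((f ∘ suc) ⋆ g) k; proofs recurse on k.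

⋆-cong : ∀ {f f'} g k → (∀ i → f i ≡ f' i) → (f ⋆ g) k ≡ (f' ⋆ g) k
⋆-cong g zero f≡f' = cong (λ x → x * g 0 + 0) (f≡f' 0)
⋆-cong g (suc k) f≡f' = cong₂ _+_ (cong (_* g (suc k)) (f≡f' 0)) (⋆-cong g k (f≡f' ∘ suc))

⋆-∑ˢ : ∀ a (F : Subset a → ℕ → ℕ) g k →
  ((λ i → ∑ˢ a (λ U → F U i)) ⋆ g) k ≡ ∑ˢ a (λ U → (F U ⋆ g) k)
⋆-∑ˢ a F g zero = begin
  ∑ˢ a (λ U → F U 0) * g 0 + 0  ≡⟨ +-identityʳ _ ⟩
  ∑ˢ a (λ U → F U 0) * g 0      ≡⟨ *-comm _ (g 0) ⟩
  g 0 * ∑ˢ a (λ U → F U 0)      ≡⟨ ∑ˢ-*ˡ a (g 0) _ ⟨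
  ∑ˢ a (λ U → g 0 * F U 0)      ≡⟨ ∑ˢ-cong a (λ U → trans (*-comm (g 0) (F U 0)) (sym (+-identityʳ _))) ⟩
  ∑ˢ a (λ U → F U 0 * g 0 + 0)  ∎
⋆-∑ˢ a F g (suc k) = begin
  ∑ˢ a (λ U → F U 0) * g (suc k) + ((λ i → ∑ˢ a (λ U → F U (suc i))) ⋆ g) k
    ≡⟨ cong₂ _+_ (trans (*-comm _ (g (suc k))) (sym (∑ˢ-*ˡ a (g (suc k)) _))) (⋆-∑ˢ a (λ U → F U ∘ suc) g k) ⟩
  ∑ˢ a (λ U → g (suc k) * F U 0) + ∑ˢ a (λ U → ((F U ∘ suc) ⋆ g) k)
    ≡⟨ ∑ˢ-+ a _ _ ⟨
  ∑ˢ a (λ U → g (suc k) * F U 0 + ((F U ∘ suc) ⋆ g) k)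
    ≡⟨ ∑ˢ-cong a (λ U → cong (_+ ((F U ∘ suc) ⋆ g) k) (*-comm (g (suc k)) (F U 0))) ⟩
  ∑ˢ a (λ U → (F U ⋆ g) (suc k)) ∎

⋆-zeroˡ : ∀ h k → ((λ _ → 0) ⋆ h) k ≡ 0
⋆-zeroˡ h zero = refl
⋆-zeroˡ h (suc k) = ⋆-zeroˡ h k

⋆-point : ∀ s x h k → ((λ i → 𝟙 (s ≡ᵇ i) * x) ⋆ h) k ≡ 𝟙 (s ≤ᵇ k) * (x * h (k ∸ s))
⋆-point zero x h zero = cong (λ y → y * h 0 + 0) (+-identityʳ x)
⋆-point (suc s) x h zero = refl
⋆-point zero x h (suc k) = cong₂ _+_ (cong (_* h (suc k)) (+-identityʳ x)) (⋆-zeroˡ h k)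
⋆-point (suc s) x h (suc k) =
  trans (⋆-point s x h k) (cong (λ b → 𝟙 b * (x * h (k ∸ s))) (sym (≤ᵇ-suc s k)))

sum-applyUpTo-+ : ∀ (φ ψ : ℕ → ℕ) n →
  sum (applyUpTo (λ i → φ i + ψ i) n) ≡ sum (applyUpTo φ n) + sum (applyUpTo ψ n)
sum-applyUpTo-+ φ ψ zero = refl
sum-applyUpTo-+ φ ψ (suc n) =
  trans (cong (φ 0 + ψ 0 +_) (sum-applyUpTo-+ (φ ∘ suc) (ψ ∘ suc) n))
        (+-interchange (φ 0) (ψ 0) (sum (applyUpTo (φ ∘ suc) n)) (sum (applyUpTo (ψ ∘ suc) n)))

-- Two convolutions at k, summed over the list [0 … k] as in the statement of the theorem.
⋆-pair-as-sum : ∀ f g f' g' k → (f ⋆ g) k + (f' ⋆ g') k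
  ≡ sum (map (λ i → f i * g (k ∸ i) + f' i * g' (k ∸ i)) (upTo (suc k)))
⋆-pair-as-sum f g f' g' k = begin
  (f ⋆ g) k + (f' ⋆ g') k
    ≡⟨ sum-applyUpTo-+ (λ i → f i * g (k ∸ i)) (λ i → f' i * g' (k ∸ i)) (suc k) ⟨
  sum (applyUpTo (λ i → f i * g (k ∸ i) + f' i * g' (k ∸ i)) (suc k))
    ≡⟨ cong sum (Listₚ.map-upTo (λ i → f i * g (k ∸ i) + f' i * g' (k ∸ i)) (suc k)) ⟨
  sum (map (λ i → f i * g (k ∸ i) + f' i * g' (k ∸ i)) (upTo (suc k))) ∎

agreesOff : ∀ {m} → Subset m → Subset m → Subset m → Bool
agreesOff D W₀ W = allᶠ (λ v → lookup D v ∨ ⌊ lookup W v Bool.≟ lookup W₀ v ⌋)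

-- The subsets that agree with W₀ outside D and have j elements inside D are the
-- j-subsets of D, hence counted by C(|D|, j) (Pascal's rule for each element of D).
extensions-count : ∀ {m} (D W₀ : Subset m) j →
  ∑ˢ m (λ W → 𝟙 (agreesOff D W₀ W) * 𝟙 (∣ W ∩ D ∣ ≡ᵇ j)) ≡ ∣ D ∣ C j
extensions-count [] [] zero = refl
extensions-count [] [] (suc j) = refl
extensions-count {suc m} (true ∷ D) (_ ∷ W₀) zero =
  cong₂ _+_ (∑ˢ-zero m (λ W → 𝟙 (agreesOff D W₀ W) * 0) (λ W → *-zeroʳ (𝟙 (agreesOff D W₀ W))))
            (extensions-count D W₀ 0)
extensions-count (true ∷ D) (_ ∷ W₀) (suc j) =
  trans (cong₂ _+_ (extensions-count D W₀ j) (extensions-count D W₀ (suc j)))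
        (nCk+nC[k+1]≡[n+1]C[k+1] ∣ D ∣ j)
extensions-count {suc m} (false ∷ D) (true ∷ W₀) j =
  trans (cong₂ _+_ (extensions-count D W₀ j) (∑ˢ-0 m)) (+-identityʳ _)
extensions-count {suc m} (false ∷ D) (false ∷ W₀) j =
  cong₂ _+_ (∑ˢ-0 m) (extensions-count D W₀ j)

_⊆ᵇ_ : ∀ {m} → Subset m → Subset m → Bool
W ⊆ᵇ D = agreesOff D ∅ W

⊆ᵇ-intro : ∀ {m} (W D : Subset m) → (∀ v → lookup W v ≡ true → lookup D v ≡ true) → W ⊆ᵇ D ≡ true
⊆ᵇ-intro {m} W D W⊆D = allᶠ-intro _ pointwise
  where
  pointwise : ∀ v → lookup D v ∨ ⌊ lookup W v Bool.≟ lookup (∅ {m}) v ⌋ ≡ true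
  pointwise v with lookup W v in e
  ... | true = ∨-introˡ _ (W⊆D v e)
  ... | false rewrite Vecₚ.lookup-replicate v false = ∨-introʳ (lookup D v) refl

⊆ᵇ-elim : ∀ {m} (W D : Subset m) → W ⊆ᵇ D ≡ true → ∀ v → lookup W v ≡ true → lookup D v ≡ true
⊆ᵇ-elim {m} W D e v v∈W with lookup D v in d
... | true = refl
... | false = ⊥-elim (true≢false v∈W (trans (⌊⌋-sound (_ Bool.≟ _) (∨-resolveˡ d (allᶠ-elim _ e v)))
                                               (Vecₚ.lookup-replicate v false)))

⊆ᵇ-∩ : ∀ {m} (D W : Subset m) → W ⊆ᵇ D ≡ true → W ∩ D ≡ W
⊆ᵇ-∩ [] [] _ = refl
⊆ᵇ-∩ (true ∷ D) (w ∷ W) e = cong₂ _∷_ (∧-identityʳ w) (⊆ᵇ-∩ D W e)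
⊆ᵇ-∩ (false ∷ D) (false ∷ W) e = cong (false ∷_) (⊆ᵇ-∩ D W e)
⊆ᵇ-∩ (false ∷ D) (true ∷ W) ()

subsets-count : ∀ {m} (D : Subset m) k → ∑ˢ m (λ W → 𝟙 (∣ W ∣ ≡ᵇ k) * 𝟙 (W ⊆ᵇ D)) ≡ ∣ D ∣ C k
subsets-count {m} D k = trans (∑ˢ-cong m pointwise) (extensions-count D ∅ k)
  where
  pointwise : ∀ W → 𝟙 (∣ W ∣ ≡ᵇ k) * 𝟙 (W ⊆ᵇ D) ≡ 𝟙 (W ⊆ᵇ D) * 𝟙 (∣ W ∩ D ∣ ≡ᵇ k)
  pointwise W with W ⊆ᵇ D in e
  ... | true rewrite ⊆ᵇ-∩ D W e = *-comm (𝟙 (∣ W ∣ ≡ᵇ k)) 1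
  ... | false = *-zeroʳ (𝟙 (∣ W ∣ ≡ᵇ k))

k-subsets-count : ∀ m k → ∑ˢ m (λ W → 𝟙 (∣ W ∣ ≡ᵇ k)) ≡ m C k
k-subsets-count m k = begin
  ∑ˢ m (λ W → 𝟙 (∣ W ∣ ≡ᵇ k))              ≡⟨ ∑ˢ-cong m (λ W → sym (*-identityʳ (𝟙 (∣ W ∣ ≡ᵇ k)))) ⟩
  ∑ˢ m (λ W → 𝟙 (∣ W ∣ ≡ᵇ k) * 1)          ≡⟨ ∑ˢ-cong m (λ W → cong (λ b → 𝟙 (∣ W ∣ ≡ᵇ k) * 𝟙 b) (W⊆⊤ W)) ⟨
  ∑ˢ m (λ W → 𝟙 (∣ W ∣ ≡ᵇ k) * 𝟙 (W ⊆ᵇ ⊤))  ≡⟨ subsets-count (⊤ {m}) k ⟩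
  ∣ ⊤ {m} ∣ C k                            ≡⟨ cong (_C k) (∣⊤∣≡n m) ⟩
  m C k                                    ∎
  where
  W⊆⊤ : ∀ W → W ⊆ᵇ ⊤ ≡ true
  W⊆⊤ W = ⊆ᵇ-intro W ⊤ (λ v _ → Vecₚ.lookup-replicate v true)

_≐_ : ∀ {n} → Subset n → Subset n → Bool
U ≐ V = allᶠ (λ x → ⌊ lookup U x Bool.≟ lookup V x ⌋)

∑ˢ-point : ∀ {a} (V : Subset a) (g : Subset a → ℕ) → ∑ˢ a (λ U → 𝟙 (U ≐ V) * g U) ≡ g V
∑ˢ-point [] g = +-identityʳ (g [])
∑ˢ-point {suc a} (true ∷ V) g = trans (cong₂ _+_ (∑ˢ-point V (g ∘ (true ∷_))) (∑ˢ-0 a)) (+-identityʳ _)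
∑ˢ-point {suc a} (false ∷ V) g = cong₂ _+_ (∑ˢ-0 a) (∑ˢ-point V (g ∘ (false ∷_)))

∣∣-as-# : ∀ {m} (W : Subset m) → ∣ W ∣ ≡ #[ lookup W ]
∣∣-as-# [] = refl
∣∣-as-# (true ∷ W) = cong suc (∣∣-as-# W)
∣∣-as-# (false ∷ W) = ∣∣-as-# W

complement-size : ∀ {m a} (p : Fin m → Bool) → #[ p ] ≡ a → ∣ tabulate (not ∘ p) ∣ ≡ m ∸ a
complement-size {m} {a} p #p≡a = begin
  ∣ tabulate (not ∘ p) ∣              ≡⟨ ∣∣-as-# (tabulate (not ∘ p)) ⟩
  #[ lookup (tabulate (not ∘ p)) ]    ≡⟨ sum-cong-≗ (λ v → cong 𝟙 (Vecₚ.lookup∘tabulate (not ∘ p) v)) ⟩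
  #[ not ∘ p ]                        ≡⟨ ℕₚ.m+n∸m≡n #[ p ] _ ⟨
  #[ p ] + #[ not ∘ p ] ∸ #[ p ]      ≡⟨ cong₂ _∸_ (#-complement m p) #p≡a ⟩
  m ∸ a                               ∎

im : ∀ {a m} → (Fin a → Fin m) → Fin m → Bool
im ι v = anyᶠ (λ x → ⌊ ι x Fin.≟ v ⌋)

im-ι : ∀ {a m} (ι : Fin a → Fin m) x → im ι (ι x) ≡ true
im-ι ι x = anyᶠ-intro _ x (⌊⌋-complete (ι x Fin.≟ ι x) refl)

im-elim : ∀ {a m} (ι : Fin a → Fin m) v → im ι v ≡ true → ∃ λ x → ι x ≡ v
im-elim ι v e with anyᶠ-elim _ e
... | x , ιx≟v = x , ⌊⌋-sound (ι x Fin.≟ v) ιx≟v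

restrict : ∀ {a m} → (Fin a → Fin m) → Subset m → Subset a
restrict ι W = tabulate (λ x → lookup W (ι x))

restrict-ι : ∀ {a m} (ι : Fin a → Fin m) W x → lookup (restrict ι W) x ≡ lookup W (ι x)
restrict-ι ι W x = Vecₚ.lookup∘tabulate _ x

-- The key
-- fact is `restriction-sum`: summing a function of W ∩ im ι over the k-subsets W of
-- Fin m convolves its sums over the i-subsets of Fin a with C(m − a, ·), since each
-- i-subset has C(m − a, k − i) extensions to a k-subset.
module Restriction {a m : ℕ} (ι : Fin a → Fin m) (ι-inj : ∀ x y → ι x ≡ ι y → x ≡ y) where

  ∑-image : ∀ (f : Fin m → ℕ) → ∑[ v < m ] (𝟙 (im ι v) * f v) ≡ ∑[ x < a ] f (ι x)
  ∑-image f = begin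
    ∑[ v < m ] (𝟙 (im ι v) * f v)
      ≡⟨ sum-cong-≗ (λ v → cong (_* f v) (sym (#-at-most-one a (hits v) (hits-once v)))) ⟩
    ∑[ v < m ] (#[ hits v ] * f v)
      ≡⟨ sum-cong-≗ (λ v → *-distribʳ-sum (f v) (𝟙 ∘ hits v)) ⟩
    ∑[ v < m ] ∑[ x < a ] (𝟙 (hits v x) * f v)
      ≡⟨ ∑-comm (λ v x → 𝟙 (hits v x) * f v) ⟩
    ∑[ x < a ] ∑[ v < m ] (𝟙 (hits v x) * f v)
      ≡⟨ sum-cong-≗ (λ x → ∑-single m _ (ι x) (λ v v≢ιx → cong (λ b → 𝟙 b * f v)
                                                 (⌊⌋-false (ι x Fin.≟ v) (v≢ιx ∘ sym)))) ⟩
    ∑[ x < a ] (𝟙 (hits (ι x) x) * f (ι x))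
      ≡⟨ sum-cong-≗ (λ x → trans (cong (λ b → 𝟙 b * f (ι x)) (⌊⌋-complete (ι x Fin.≟ ι x) refl))
                                  (+-identityʳ (f (ι x)))) ⟩
    ∑[ x < a ] f (ι x) ∎
    where
    hits : Fin m → Fin a → Bool
    hits v x = ⌊ ι x Fin.≟ v ⌋
    hits-once : ∀ v x y → hits v x ≡ true → hits v y ≡ true → x ≡ y
    hits-once v x y hx hy = ι-inj x y (trans (⌊⌋-sound (ι x Fin.≟ v) hx) (sym (⌊⌋-sound (ι y Fin.≟ v) hy)))

  image-size : #[ im ι ] ≡ a
  image-size = trans (sum-cong-≗ (λ v → sym (*-identityʳ (𝟙 (im ι v))))) (trans (∑-image (λ _ → 1)) (∑-ones a))

  outside : Subset m
  outside = tabulate (not ∘ im ι)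

  outside-size : ∣ outside ∣ ≡ m ∸ a
  outside-size = complement-size (im ι) image-size

  outside-or-image : ∀ v → lookup outside v ≡ true ⊎ ∃ λ x → ι x ≡ v
  outside-or-image v with im ι v in e
  ... | false = inj₁ (trans (Vecₚ.lookup∘tabulate _ v) (cong not e))
  ... | true = inj₂ (im-elim ι v e)

  outside-ι : ∀ x → lookup outside (ι x) ≡ false
  outside-ι x = trans (Vecₚ.lookup∘tabulate _ (ι x)) (cong not (im-ι ι x))

  -- U ⊆ Fin a transported to Fin m (the smallest W with restrict ι W = U).
  push : Subset a → Subset m
  push U = tabulate (λ v → anyᶠ (λ x → ⌊ ι x Fin.≟ v ⌋ ∧ lookup U x))

  push-ι : ∀ U x → lookup (push U) (ι x) ≡ lookup U x
  push-ι U x = trans (Vecₚ.lookup∘tabulate _ (ι x)) (bool-ext found (anyᶠ-intro _ x ∘ hit-x))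
    where
    hit-x : lookup U x ≡ true → ⌊ ι x Fin.≟ ι x ⌋ ∧ lookup U x ≡ true
    hit-x = ∧-intro (⌊⌋-complete (ι x Fin.≟ ι x) refl)
    found : anyᶠ (λ y → ⌊ ι y Fin.≟ ι x ⌋ ∧ lookup U y) ≡ true → lookup U x ≡ true
    found e with anyᶠ-elim _ e
    ... | y , hit with ∧-elim {⌊ ι y Fin.≟ ι x ⌋} hit
    ...   | ιy≡ιx , Uy = subst (λ z → lookup U z ≡ true) (ι-inj y x (⌊⌋-sound (ι y Fin.≟ ι x) ιy≡ιx)) Uy

  fibre-agrees : ∀ U W → (U ≐ restrict ι W) ≡ agreesOff outside (push U) W
  fibre-agrees U W = bool-ext to-agree from-agree
    where
    to-agree : (U ≐ restrict ι W) ≡ true → agreesOff outside (push U) W ≡ true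
    to-agree e = allᶠ-intro _ pointwise
      where
      pointwise : ∀ v → lookup outside v ∨ ⌊ lookup W v Bool.≟ lookup (push U) v ⌋ ≡ true
      pointwise v with outside-or-image v
      ... | inj₁ out = ∨-introˡ _ out
      ... | inj₂ (x , refl) = ∨-introʳ _ (⌊⌋-complete (_ Bool.≟ _) (begin
        lookup W (ι x)            ≡⟨ restrict-ι ι W x ⟨
        lookup (restrict ι W) x   ≡⟨ ⌊⌋-sound (_ Bool.≟ _) (allᶠ-elim _ e x) ⟨
        lookup U x                ≡⟨ push-ι U x ⟨
        lookup (push U) (ι x)     ∎))
    from-agree : agreesOff outside (push U) W ≡ true → (U ≐ restrict ι W) ≡ true
    from-agree e = allᶠ-intro _ (λ x → ⌊⌋-complete (_ Bool.≟ _) (begin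
      lookup U x                ≡⟨ push-ι U x ⟨
      lookup (push U) (ι x)     ≡⟨ ⌊⌋-sound (_ Bool.≟ _) (∨-resolveˡ (outside-ι x) (allᶠ-elim _ e (ι x))) ⟨
      lookup W (ι x)            ≡⟨ restrict-ι ι W x ⟨
      lookup (restrict ι W) x   ∎))

  size-split : ∀ U W → (U ≐ restrict ι W) ≡ true → ∣ W ∣ ≡ ∣ U ∣ + ∣ W ∩ outside ∣
  size-split U W e = begin
    ∣ W ∣
      ≡⟨ ∣∣-as-# W ⟩
    ∑[ v < m ] 𝟙 (lookup W v)
      ≡⟨ sum-cong-≗ split-at ⟩
    ∑[ v < m ] (𝟙 (im ι v) * 𝟙 (lookup W v) + 𝟙 (lookup (W ∩ outside) v))
      ≡⟨ ∑-distrib-+ (λ v → 𝟙 (im ι v) * 𝟙 (lookup W v)) (𝟙 ∘ lookup (W ∩ outside)) ⟩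
    ∑[ v < m ] (𝟙 (im ι v) * 𝟙 (lookup W v)) + #[ lookup (W ∩ outside) ]
      ≡⟨ cong₂ _+_ (∑-image (𝟙 ∘ lookup W)) (sym (∣∣-as-# (W ∩ outside))) ⟩
    ∑[ x < a ] 𝟙 (lookup W (ι x)) + ∣ W ∩ outside ∣
      ≡⟨ cong (_+ ∣ W ∩ outside ∣) (sum-cong-≗ (λ x → cong 𝟙 (U≗W∘ι x))) ⟨
    #[ lookup U ] + ∣ W ∩ outside ∣
      ≡⟨ cong (_+ ∣ W ∩ outside ∣) (∣∣-as-# U) ⟨
    ∣ U ∣ + ∣ W ∩ outside ∣ ∎
    where
    U≗W∘ι : ∀ x → lookup U x ≡ lookup W (ι x)
    U≗W∘ι x = trans (⌊⌋-sound (_ Bool.≟ _) (allᶠ-elim _ e x)) (restrict-ι ι W x)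
    split : ∀ w i → 𝟙 w ≡ 𝟙 i * 𝟙 w + 𝟙 (w ∧ not i)
    split true true = refl
    split true false = refl
    split false true = refl
    split false false = refl
    split-at : ∀ v → 𝟙 (lookup W v) ≡ 𝟙 (im ι v) * 𝟙 (lookup W v) + 𝟙 (lookup (W ∩ outside) v)
    split-at v rewrite Vecₚ.lookup-zipWith _∧_ v W outside | Vecₚ.lookup∘tabulate (not ∘ im ι) v =
      split (lookup W v) (im ι v)

  fibre-count : ∀ U k → ∑ˢ m (λ W → 𝟙 (∣ W ∣ ≡ᵇ k) * 𝟙 (U ≐ restrict ι W))
                         ≡ 𝟙 (∣ U ∣ ≤ᵇ k) * (∣ outside ∣ C (k ∸ ∣ U ∣))
  fibre-count U k = begin
    ∑ˢ m (λ W → 𝟙 (∣ W ∣ ≡ᵇ k) * 𝟙 (U ≐ restrict ι W))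
      ≡⟨ ∑ˢ-cong m pointwise ⟩
    ∑ˢ m (λ W → 𝟙 (∣ U ∣ ≤ᵇ k) * (𝟙 (agreesOff outside (push U) W) * 𝟙 (∣ W ∩ outside ∣ ≡ᵇ k ∸ ∣ U ∣)))
      ≡⟨ ∑ˢ-*ˡ m (𝟙 (∣ U ∣ ≤ᵇ k)) _ ⟩
    𝟙 (∣ U ∣ ≤ᵇ k) * ∑ˢ m (λ W → 𝟙 (agreesOff outside (push U) W) * 𝟙 (∣ W ∩ outside ∣ ≡ᵇ k ∸ ∣ U ∣))
      ≡⟨ cong (𝟙 (∣ U ∣ ≤ᵇ k) *_) (extensions-count outside (push U) (k ∸ ∣ U ∣)) ⟩
    𝟙 (∣ U ∣ ≤ᵇ k) * (∣ outside ∣ C (k ∸ ∣ U ∣)) ∎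
    where
    pointwise : ∀ W → 𝟙 (∣ W ∣ ≡ᵇ k) * 𝟙 (U ≐ restrict ι W)
      ≡ 𝟙 (∣ U ∣ ≤ᵇ k) * (𝟙 (agreesOff outside (push U) W) * 𝟙 (∣ W ∩ outside ∣ ≡ᵇ k ∸ ∣ U ∣))
    pointwise W rewrite sym (fibre-agrees U W) with U ≐ restrict ι W in e
    ... | true rewrite size-split U W e =
      trans (*-identityʳ _) (trans (≡ᵇ-split ∣ U ∣ ∣ W ∩ outside ∣ k)
            (cong (𝟙 (∣ U ∣ ≤ᵇ k) *_) (sym (+-identityʳ _))))
    ... | false = trans (*-zeroʳ (𝟙 (∣ W ∣ ≡ᵇ k))) (sym (*-zeroʳ (𝟙 (∣ U ∣ ≤ᵇ k))))

  restriction-sum : ∀ (g : Subset a → ℕ) k →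
    ∑ˢ m (λ W → 𝟙 (∣ W ∣ ≡ᵇ k) * g (restrict ι W))
    ≡ ((λ i → ∑ˢ a (λ U → 𝟙 (∣ U ∣ ≡ᵇ i) * g U)) ⋆ (∣ outside ∣ C_)) k
  restriction-sum g k = begin
    ∑ˢ m (λ W → 𝟙 (∣ W ∣ ≡ᵇ k) * g (restrict ι W))
      ≡⟨ ∑ˢ-cong m (λ W → cong (𝟙 (∣ W ∣ ≡ᵇ k) *_) (sym (∑ˢ-point (restrict ι W) g))) ⟩
    ∑ˢ m (λ W → 𝟙 (∣ W ∣ ≡ᵇ k) * ∑ˢ a (λ U → 𝟙 (U ≐ restrict ι W) * g U))
      ≡⟨ ∑ˢ-cong m (λ W → sym (∑ˢ-*ˡ a (𝟙 (∣ W ∣ ≡ᵇ k)) _)) ⟩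
    ∑ˢ m (λ W → ∑ˢ a (λ U → 𝟙 (∣ W ∣ ≡ᵇ k) * (𝟙 (U ≐ restrict ι W) * g U)))
      ≡⟨ ∑ˢ-comm m a _ ⟩
    ∑ˢ a (λ U → ∑ˢ m (λ W → 𝟙 (∣ W ∣ ≡ᵇ k) * (𝟙 (U ≐ restrict ι W) * g U)))
      ≡⟨ ∑ˢ-cong a (λ U → ∑ˢ-cong m (λ W → rotate (𝟙 (∣ W ∣ ≡ᵇ k)) (𝟙 (U ≐ restrict ι W)) (g U))) ⟩
    ∑ˢ a (λ U → ∑ˢ m (λ W → g U * (𝟙 (∣ W ∣ ≡ᵇ k) * 𝟙 (U ≐ restrict ι W))))
      ≡⟨ ∑ˢ-cong a (λ U → ∑ˢ-*ˡ m (g U) _) ⟩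
    ∑ˢ a (λ U → g U * ∑ˢ m (λ W → 𝟙 (∣ W ∣ ≡ᵇ k) * 𝟙 (U ≐ restrict ι W)))
      ≡⟨ ∑ˢ-cong a (λ U → cong (g U *_) (fibre-count U k)) ⟩
    ∑ˢ a (λ U → g U * (𝟙 (∣ U ∣ ≤ᵇ k) * (∣ outside ∣ C (k ∸ ∣ U ∣))))
      ≡⟨ ∑ˢ-cong a (λ U → swap (g U) (𝟙 (∣ U ∣ ≤ᵇ k)) _) ⟩
    ∑ˢ a (λ U → 𝟙 (∣ U ∣ ≤ᵇ k) * (g U * (∣ outside ∣ C (k ∸ ∣ U ∣))))
      ≡⟨ ∑ˢ-cong a (λ U → sym (⋆-point ∣ U ∣ (g U) (∣ outside ∣ C_) k)) ⟩
    ∑ˢ a (λ U → ((λ i → 𝟙 (∣ U ∣ ≡ᵇ i) * g U) ⋆ (∣ outside ∣ C_)) k)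
      ≡⟨ ⋆-∑ˢ a (λ U i → 𝟙 (∣ U ∣ ≡ᵇ i) * g U) (∣ outside ∣ C_) k ⟨
    ((λ i → ∑ˢ a (λ U → 𝟙 (∣ U ∣ ≡ᵇ i) * g U)) ⋆ (∣ outside ∣ C_)) k ∎
    where
    rotate : ∀ x y z → x * (y * z) ≡ z * (x * y)
    rotate = solve-∀
    swap : ∀ x y z → x * (y * z) ≡ y * (x * z)
    swap = solve-∀

  c-restriction-sum : ∀ (H : Graph a) k →
    ∑ˢ m (λ W → 𝟙 (∣ W ∣ ≡ᵇ k) * nc H (restrict ι W)) ≡ ((λ i → c i H) ⋆ ((m ∸ a) C_)) k
  c-restriction-sum H k = begin
    ∑ˢ m (λ W → 𝟙 (∣ W ∣ ≡ᵇ k) * nc H (restrict ι W))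
      ≡⟨ restriction-sum (nc H) k ⟩
    ((λ i → ∑ˢ a (λ U → 𝟙 (∣ U ∣ ≡ᵇ i) * nc H U)) ⋆ (∣ outside ∣ C_)) k
      ≡⟨ ⋆-cong (∣ outside ∣ C_) k (λ i → sym (c-as-∑ˢ i H)) ⟩
    ((λ i → c i H) ⋆ (∣ outside ∣ C_)) k
      ≡⟨ cong (λ d → ((λ i → c i H) ⋆ (d C_)) k) outside-size ⟩
    ((λ i → c i H) ⋆ ((m ∸ a) C_)) k ∎

length-filter-tabulate : ∀ {A : Set} n (p : A → Bool) (g : Fin n → A) →
  length (filterᵇ p (List.tabulate g)) ≡ ∑[ i < n ] 𝟙 (p (g i))
length-filter-tabulate zero p g = refl
length-filter-tabulate (suc n) p g with p (g zero)
... | true = cong suc (length-filter-tabulate n p (g ∘ suc))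
... | false = length-filter-tabulate n p (g ∘ suc)

module Reach {n : ℕ} (G : Graph n) (W : Subset n) where

  walk : ℕ → Fin n → Fin n → Bool
  walk = reach G W

  walk-zero-elim : ∀ u v → walk 0 u v ≡ true → lookup W u ≡ true × u ≡ v
  walk-zero-elim u v e with ∧-elim {lookup W u} e
  ... | u∈W , u≟v = u∈W , ⌊⌋-sound (u Fin.≟ v) u≟v

  walk-zero : ∀ u → lookup W u ≡ true → walk 0 u u ≡ true
  walk-zero u u∈W = ∧-intro u∈W (⌊⌋-complete (u Fin.≟ u) refl)

  walk-weaken : ∀ s u v → walk s u v ≡ true → walk (suc s) u v ≡ true
  walk-weaken s u v = ∨-introˡ _

  walk-weaken≤ : ∀ s s' u v → s ≤ s' → walk s u v ≡ true → walk s' u v ≡ true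
  walk-weaken≤ s zero u v z≤n e = e
  walk-weaken≤ s (suc s') u v s≤ e with ℕₚ.m≤n⇒m<n∨m≡n s≤
  ... | inj₂ refl = e
  ... | inj₁ (s≤s s≤s') = walk-weaken s' u v (walk-weaken≤ s s' u v s≤s' e)

  walk-snoc : ∀ s u w v → walk s u w ≡ true → adj G w v ≡ true → lookup W v ≡ true →
    walk (suc s) u v ≡ true
  walk-snoc s u w v uw wv v∈W = ∨-introʳ (walk s u v) (anyᶠ-intro _ w (∧-intro uw (∧-intro wv v∈W)))

  walk-suc-elim : ∀ s u v → walk (suc s) u v ≡ true →
    walk s u v ≡ true ⊎ ∃ λ w → walk s u w ≡ true × adj G w v ≡ true × lookup W v ≡ true
  walk-suc-elim s u v e with ∨-elim {walk s u v} e
  ... | inj₁ short = inj₁ short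
  ... | inj₂ step with anyᶠ-elim _ step
  ...   | w , hit with ∧-elim {walk s u w} hit
  ...     | uw , rest with ∧-elim {adj G w v} rest
  ...       | wv , v∈W = inj₂ (w , uw , wv , v∈W)

  walk-start : ∀ s u v → walk s u v ≡ true → lookup W u ≡ true
  walk-start zero u v e = proj₁ (walk-zero-elim u v e)
  walk-start (suc s) u v e with walk-suc-elim s u v e
  ... | inj₁ short = walk-start s u v short
  ... | inj₂ (w , uw , _) = walk-start s u w uw

  walk-end : ∀ s u v → walk s u v ≡ true → lookup W v ≡ true
  walk-end zero u v e with walk-zero-elim u v e
  ... | u∈W , refl = u∈W
  walk-end (suc s) u v e with walk-suc-elim s u v e
  ... | inj₁ short = walk-end s u v short
  ... | inj₂ (_ , _ , _ , v∈W) = v∈W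

  walk-cons : ∀ s u w v → lookup W u ≡ true → adj G u w ≡ true → walk s w v ≡ true →
    walk (suc s) u v ≡ true
  walk-cons zero u w v u∈W uw e with walk-zero-elim w v e
  ... | w∈W , refl = walk-snoc 0 u u w (walk-zero u u∈W) uw w∈W
  walk-cons (suc s) u w v u∈W uw e with walk-suc-elim s w v e
  ... | inj₁ short = walk-weaken (suc s) u v (walk-cons s u w v u∈W uw short)
  ... | inj₂ (x , wx , xv , v∈W) = walk-snoc (suc s) u x v (walk-cons s u w x u∈W uw wx) xv v∈W

  walk-sym : ∀ s u v → walk s u v ≡ true → walk s v u ≡ true
  walk-sym zero u v e with walk-zero-elim u v e
  ... | _ , refl = e
  walk-sym (suc s) u v e with walk-suc-elim s u v e
  ... | inj₁ short = walk-weaken s v u (walk-sym s u v short)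
  ... | inj₂ (w , uw , wv , v∈W) = walk-cons s v w u v∈W (trans (adj-sym G v w) wv) (walk-sym s u w uw)

  walk-trans : ∀ s t u v w → walk s u v ≡ true → walk t v w ≡ true → walk (t + s) u w ≡ true
  walk-trans s zero u v w uv e with walk-zero-elim v w e
  ... | _ , refl = uv
  walk-trans s (suc t) u v w uv e with walk-suc-elim t v w e
  ... | inj₁ short = walk-weaken (t + s) u w (walk-trans s t u v w uv short)
  ... | inj₂ (x , vx , xw , w∈W) = walk-snoc (t + s) u x w (walk-trans s t u v x uv vx) xw w∈W

  -- Walks of length ≤ n already reach everything reachable from u: the sets
  -- {v | walk s u v} grow with s, strictly until they stop growing, and have ≤ n elements.
  module Saturation (u : Fin n) (u∈W : lookup W u ≡ true) where

    reached : ℕ → ℕ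
    reached s = #[ walk s u ]

    Closed : ℕ → Set
    Closed s = ∀ v → walk (suc s) u v ≡ true → walk s u v ≡ true

    closed-absorbs : ∀ s → Closed s → ∀ j v → walk j u v ≡ true → walk s u v ≡ true
    closed-absorbs s closed zero v e = walk-weaken≤ 0 s u v z≤n e
    closed-absorbs s closed (suc j) v e with walk-suc-elim j u v e
    ... | inj₁ short = closed-absorbs s closed j v short
    ... | inj₂ (w , uw , wv , v∈W) = closed v (walk-snoc s u w v (closed-absorbs s closed j w uw) wv v∈W)

    closed-suc : ∀ s → Closed s → Closed (suc s)
    closed-suc s closed v e = walk-weaken s u v (closed-absorbs s closed (suc (suc s)) v e)

    grows-or-closed : ∀ s → suc s ≤ reached s ⊎ Closed s
    grows-or-closed zero =
      inj₁ (subst (λ b → 𝟙 b ≤ reached 0) (walk-zero u u∈W) (term≤∑ n (𝟙 ∘ walk 0 u) u))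
    grows-or-closed (suc s) with grows-or-closed s
    ... | inj₂ closed = inj₂ (closed-suc s closed)
    ... | inj₁ grown with reached (suc s) ℕₚ.≤? reached s
    ...   | yes no-growth = inj₂ (closed-suc s (#-⊆-antisym n (walk s u) (walk (suc s) u) (walk-weaken s u) no-growth))
    ...   | no growth = inj₁ (ℕₚ.≤-trans (s≤s grown) (ℕₚ.≰⇒> growth))

    -- Hence at step n the reached set is closed (it cannot hold n + 1 vertices).
    saturated : ∀ j v → walk j u v ≡ true → walk n u v ≡ true
    saturated j v e with grows-or-closed n
    ... | inj₁ too-many = ⊥-elim (ℕₚ.<⇒≱ too-many (#-≤ n (walk n u)))
    ... | inj₂ closed = closed-absorbs n closed j v e

  _∼_ : Fin n → Fin n → Bool
  u ∼ v = connIn G W u v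

  walk⇒∼ : ∀ j u v → walk j u v ≡ true → u ∼ v ≡ true
  walk⇒∼ j u v e = Saturation.saturated u (walk-start j u v e) j v e

  ∼-refl : ∀ u → lookup W u ≡ true → u ∼ u ≡ true
  ∼-refl u u∈W = walk⇒∼ 0 u u (walk-zero u u∈W)

  ∼-sym : ∀ u v → u ∼ v ≡ true → v ∼ u ≡ true
  ∼-sym = walk-sym n

  ∼-trans : ∀ u v w → u ∼ v ≡ true → v ∼ w ≡ true → u ∼ w ≡ true
  ∼-trans u v w uv vw = walk⇒∼ (n + n) u w (walk-trans n n u v w uv vw)

  ∼-start : ∀ u v → u ∼ v ≡ true → lookup W u ≡ true
  ∼-start = walk-start n

  ∼-end : ∀ u v → u ∼ v ≡ true → lookup W v ≡ true
  ∼-end = walk-end n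

  edge⇒∼ : ∀ u v → lookup W u ≡ true → lookup W v ≡ true → adj G u v ≡ true → u ∼ v ≡ true
  edge⇒∼ u v u∈W v∈W uv = walk⇒∼ 1 u v (walk-snoc 0 u u v (walk-zero u u∈W) uv v∈W)

  isLeast : Fin n → Bool
  isLeast v = lookup W v ∧ not (any (λ u → (toℕ u <ᵇ toℕ v) ∧ u ∼ v) (allFin n))

  nc-as-# : nc G W ≡ #[ isLeast ]
  nc-as-# = length-filter-tabulate n isLeast (λ i → i)

  isLeast-∈ : ∀ v → isLeast v ≡ true → lookup W v ≡ true
  isLeast-∈ v least = proj₁ (∧-elim {lookup W v} least)

  isLeast-minimal : ∀ u v → isLeast v ≡ true → toℕ u < toℕ v → u ∼ v ≡ true → ⊥
  isLeast-minimal u v least u<v uv with ∧-elim {lookup W v} least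
  ... | _ , none-smaller =
    true≢false (anyᶠ-intro _ u (∧-intro (to T-≡ (ℕₚ.<⇒<ᵇ u<v)) uv)) (not≡true none-smaller)

  -- Every vertex of W is connected to a least vertex of its component
  -- (descend along smaller connected vertices; `bound` bounds the descent).
  least-below : ∀ bound v w → toℕ v < bound → v ∼ w ≡ true → ∃ λ u → isLeast u ≡ true × u ∼ w ≡ true
  least-below (suc bound) v w v<bound vw with isLeast v in least
  ... | true = v , least , vw
  ... | false with anyᶠ-elim _ (smaller-exists (∼-start v w vw) least)
    where
    smaller-exists : lookup W v ≡ true → isLeast v ≡ false →
      anyᶠ (λ u → (toℕ u <ᵇ toℕ v) ∧ u ∼ v) ≡ true
    smaller-exists v∈W not-least rewrite v∈W = not≡false not-least
  ...   | u , hit with ∧-elim {toℕ u <ᵇ toℕ v} hit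
  ...     | u<v , uv = least-below bound u w
                         (ℕₚ.≤-trans (ℕₚ.<ᵇ⇒< _ _ (from T-≡ u<v)) (ℕₚ.≤-pred v<bound)) (∼-trans u v w uv vw)

  one-least-per-component : ∀ v → lookup W v ≡ true → #[ (λ u → isLeast u ∧ u ∼ v) ] ≡ 1
  one-least-per-component v v∈W with least-below (suc (toℕ v)) v v ℕₚ.≤-refl (∼-refl v v∈W)
  ... | u₀ , least₀ , u₀v =
    trans (∑-single n _ u₀ others-fail) (cong 𝟙 (∧-intro least₀ u₀v))
    where
    others-fail : ∀ u → u ≢ u₀ → 𝟙 (isLeast u ∧ u ∼ v) ≡ 0
    others-fail u u≢u₀ with isLeast u ∧ u ∼ v in e
    ... | false = refl
    ... | true with ∧-elim {isLeast u} e
    ...   | least , uv with Finₚ.<-cmp u u₀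
    ...     | tri< u<u₀ _ _ = ⊥-elim (isLeast-minimal u u₀ least₀ u<u₀ (∼-trans u v u₀ uv (∼-sym u₀ v u₀v)))
    ...     | tri≈ _ u≡u₀ _ = ⊥-elim (u≢u₀ u≡u₀)
    ...     | tri> _ _ u₀<u = ⊥-elim (isLeast-minimal u₀ u least u₀<u (∼-trans u₀ v u u₀v (∼-sym u v uv)))

walk-mono : ∀ {n} (G : Graph n) {W' W : Subset n} → (∀ v → lookup W' v ≡ true → lookup W v ≡ true) →
  ∀ s u v → reach G W' s u v ≡ true → reach G W s u v ≡ true
walk-mono G {W'} {W} W'⊆W zero u v e with Reach.walk-zero-elim G W' u v e
... | u∈W' , refl = Reach.walk-zero G W u (W'⊆W u u∈W')
walk-mono G {W'} {W} W'⊆W (suc s) u v e with Reach.walk-suc-elim G W' s u v e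
... | inj₁ short = Reach.walk-weaken G W s u v (walk-mono G W'⊆W s u v short)
... | inj₂ (w , uw , wv , v∈W') = Reach.walk-snoc G W s u w v (walk-mono G W'⊆W s u w uw) wv (W'⊆W v v∈W')

record Gluing {m a₁ a₂ : ℕ} (G : Graph m) (H₁ : Graph a₁) (H₂ : Graph a₂) : Set where
  field
    ι₁ : Fin a₁ → Fin m
    ι₂ : Fin a₂ → Fin m
    ι₁-inj : ∀ x y → ι₁ x ≡ ι₁ y → x ≡ y
    ι₂-inj : ∀ x y → ι₂ x ≡ ι₂ y → x ≡ y
    adj₁ : ∀ x y → adj G (ι₁ x) (ι₁ y) ≡ adj H₁ x y
    adj₂ : ∀ x y → adj G (ι₂ x) (ι₂ y) ≡ adj H₂ x y
    covers : ∀ v → im ι₁ v ∨ im ι₂ v ≡ true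
    edge-inside : ∀ u v → adj G u v ≡ true →
      (im ι₁ u ∧ im ι₁ v ≡ true) ⊎ (im ι₂ u ∧ im ι₂ v ≡ true)
    shared-clique : ∀ u v → im ι₁ u ∧ im ι₂ u ≡ true → im ι₁ v ∧ im ι₂ v ≡ true → u ≢ v →
      adj G u v ≡ true

swap-sides : ∀ {m a₁ a₂} {G : Graph m} {H₁ : Graph a₁} {H₂ : Graph a₂} → Gluing G H₁ H₂ → Gluing G H₂ H₁
swap-sides gl = record
  { ι₁ = ι₂ ; ι₂ = ι₁ ; ι₁-inj = ι₂-inj ; ι₂-inj = ι₁-inj ; adj₁ = adj₂ ; adj₂ = adj₁
  ; covers = λ v → trans (∨-comm (im ι₂ v) (im ι₁ v)) (covers v)
  ; edge-inside = λ u v uv → ⊎-swap (edge-inside u v uv)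
  ; shared-clique = λ u v u∈ v∈ → shared-clique u v (trans (∧-comm (im ι₁ u) (im ι₂ u)) u∈)
                                                       (trans (∧-comm (im ι₁ v) (im ι₂ v)) v∈)
  }
  where open Gluing gl

module FirstSide {m a₁ a₂ : ℕ} {G : Graph m} {H₁ : Graph a₁} {H₂ : Graph a₂}
                 (gl : Gluing G H₁ H₂) (W : Subset m) where

  open Gluing gl
  open Reach G W

  shared : Fin m → Bool
  shared v = im ι₁ v ∧ im ι₂ v

  W₁ : Subset m
  W₁ = tabulate (λ v → lookup W v ∧ im ι₁ v)

  module R₁ = Reach G W₁

  _∼₁_ : Fin m → Fin m → Bool
  _∼₁_ = R₁._∼_

  W₁-lookup : ∀ v → lookup W₁ v ≡ lookup W v ∧ im ι₁ v
  W₁-lookup v = Vecₚ.lookup∘tabulate (λ v → lookup W v ∧ im ι₁ v) v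

  W₁-intro : ∀ v → lookup W v ≡ true → im ι₁ v ≡ true → lookup W₁ v ≡ true
  W₁-intro v v∈W v∈im = trans (W₁-lookup v) (∧-intro v∈W v∈im)

  W₁⊆W : ∀ v → lookup W₁ v ≡ true → lookup W v ≡ true
  W₁⊆W v e = proj₁ (∧-elim {lookup W v} (trans (sym (W₁-lookup v)) e))

  ∼₁⇒∼ : ∀ u w → u ∼₁ w ≡ true → u ∼ w ≡ true
  ∼₁⇒∼ = walk-mono G W₁⊆W m

  ∼₁-snoc : ∀ u x w → u ∼₁ x ≡ true → adj G x w ≡ true → lookup W₁ w ≡ true → u ∼₁ w ≡ true
  ∼₁-snoc u x w ux xw w∈W₁ = R₁.walk⇒∼ (suc m) u w (R₁.walk-snoc m u x w ux xw w∈W₁)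

  -- What a walk in G|_W starting at u ∈ im ι₁ says about its end w: if w ∈ im ι₁,
  -- then u and w are connected inside W₁; otherwise the walk met the shared part.
  Trace : Fin m → Fin m → Set
  Trace u w = (im ι₁ w ≡ true → u ∼₁ w ≡ true) ×
              (im ι₁ w ≡ false → ∃ λ f → shared f ≡ true × lookup W f ≡ true × u ∼₁ f ≡ true)

  trace : ∀ u → im ι₁ u ≡ true → lookup W u ≡ true → ∀ s w → walk s u w ≡ true → Trace u w
  trace u u∈im u∈W zero w e with walk-zero-elim u w e
  ... | _ , refl = (λ _ → R₁.∼-refl u (W₁-intro u u∈W u∈im)) , (λ u∉im → ⊥-elim (true≢false u∈im u∉im))
  trace u u∈im u∈W (suc s) w e with walk-suc-elim s u w e
  ... | inj₁ short = trace u u∈im u∈W s w short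
  ... | inj₂ (x , ux , xw , w∈W) = last-edge (im ι₁ x) refl (im ι₁ w) refl
    where
    trace-x : Trace u x
    trace-x = trace u u∈im u∈W s x ux
    last-edge : ∀ bx → im ι₁ x ≡ bx → ∀ bw → im ι₁ w ≡ bw → Trace u w
    last-edge true x∈ true w∈ =
      (λ _ → ∼₁-snoc u x w (proj₁ trace-x x∈) xw (W₁-intro w w∈W w∈)) , (λ w∉ → ⊥-elim (true≢false w∈ w∉))
    last-edge true x∈ false w∉ = (λ w∈ → ⊥-elim (true≢false w∈ w∉)) , (λ _ → via-x (edge-inside x w xw))
      where
      -- the edge x–w leaves im ι₁, so it lies in im ι₂ and x is shared
      via-x : (im ι₁ x ∧ im ι₁ w ≡ true) ⊎ (im ι₂ x ∧ im ι₂ w ≡ true) →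
              ∃ λ f → shared f ≡ true × lookup W f ≡ true × u ∼₁ f ≡ true
      via-x (inj₁ inside₁) = ⊥-elim (true≢false (proj₂ (∧-elim {im ι₁ x} inside₁)) w∉)
      via-x (inj₂ inside₂) =
        x , ∧-intro x∈ (proj₁ (∧-elim {im ι₂ x} inside₂)) , walk-end s u x ux , proj₁ trace-x x∈
    last-edge false x∉ true w∈ = (λ _ → re-enter (proj₂ trace-x x∉) (edge-inside x w xw)) , (λ w∉ → ⊥-elim (true≢false w∈ w∉))
      where
      -- the walk re-enters im ι₁ at w from im ι₂, so w is shared and adjacent
      -- (or equal) to the shared vertex f met before
      re-enter : (∃ λ f → shared f ≡ true × lookup W f ≡ true × u ∼₁ f ≡ true) →
                 (im ι₁ x ∧ im ι₁ w ≡ true) ⊎ (im ι₂ x ∧ im ι₂ w ≡ true) → u ∼₁ w ≡ true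
      re-enter _ (inj₁ inside₁) = ⊥-elim (true≢false (proj₁ (∧-elim {im ι₁ x} inside₁)) x∉)
      re-enter (f , f∈ , _ , uf) (inj₂ inside₂) with f Fin.≟ w
      ... | yes refl = uf
      ... | no f≢w = ∼₁-snoc u f w uf
                       (shared-clique f w f∈ (∧-intro w∈ (proj₂ (∧-elim {im ι₂ x} inside₂))) f≢w)
                       (W₁-intro w w∈W w∈)
    last-edge false x∉ false w∉ = (λ w∈ → ⊥-elim (true≢false w∈ w∉)) , (λ _ → proj₂ trace-x x∉)

  connected-within : ∀ u w → im ι₁ u ≡ true → im ι₁ w ≡ true → u ∼ w ≡ true → u ∼₁ w ≡ true
  connected-within u w u∈ w∈ uw = proj₁ (trace u u∈ (∼-start u w uw) m w uw) w∈

  crosses-shared : ∀ u w → im ι₁ u ≡ true → im ι₁ w ≡ false → u ∼ w ≡ true →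
    ∃ λ f → shared f ≡ true × lookup W f ≡ true × u ∼ f ≡ true
  crosses-shared u w u∈ w∉ uw with proj₂ (trace u u∈ (∼-start u w uw) m w uw) w∉
  ... | f , f∈ , f∈W , uf = f , f∈ , f∈W , ∼₁⇒∼ u f uf

  shared-connected : ∀ f f' → shared f ≡ true → shared f' ≡ true →
    lookup W f ≡ true → lookup W f' ≡ true → f ∼ f' ≡ true
  shared-connected f f' f∈ f'∈ f∈W f'∈W with f Fin.≟ f'
  ... | yes refl = ∼-refl f f∈W
  ... | no f≢f' = edge⇒∼ f f' f∈W f'∈W (shared-clique f f' f∈ f'∈ f≢f')

  -- H₁|_(W ∩ im ι₁) is isomorphic, via ι₁, to G|_W₁.
  module Rₕ = Reach H₁ (restrict ι₁ W)

  W₁-ι : ∀ x → lookup W₁ (ι₁ x) ≡ lookup (restrict ι₁ W) x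
  W₁-ι x = begin
    lookup W₁ (ι₁ x)                  ≡⟨ W₁-lookup (ι₁ x) ⟩
    lookup W (ι₁ x) ∧ im ι₁ (ι₁ x)    ≡⟨ cong (lookup W (ι₁ x) ∧_) (im-ι ι₁ x) ⟩
    lookup W (ι₁ x) ∧ true            ≡⟨ ∧-identityʳ _ ⟩
    lookup W (ι₁ x)                   ≡⟨ restrict-ι ι₁ W x ⟨
    lookup (restrict ι₁ W) x          ∎

  ≟-ι₁ : ∀ x y → ⌊ x Fin.≟ y ⌋ ≡ ⌊ ι₁ x Fin.≟ ι₁ y ⌋
  ≟-ι₁ x y = bool-ext (λ e → ⌊⌋-complete (ι₁ x Fin.≟ ι₁ y) (cong ι₁ (⌊⌋-sound (x Fin.≟ y) e)))
                      (λ e → ⌊⌋-complete (x Fin.≟ y) (ι₁-inj x y (⌊⌋-sound (ι₁ x Fin.≟ ι₁ y) e)))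

  walk-transport : ∀ s x y → Rₕ.walk s x y ≡ R₁.walk s (ι₁ x) (ι₁ y)
  walk-transport zero x y = cong₂ _∧_ (sym (W₁-ι x)) (≟-ι₁ x y)
  walk-transport (suc s) x y = cong₂ _∨_ (walk-transport s x y) (bool-ext to-G from-G)
    where
    step-transport : ∀ z → Rₕ.walk s x z ∧ (adj H₁ z y ∧ lookup (restrict ι₁ W) y)
                         ≡ R₁.walk s (ι₁ x) (ι₁ z) ∧ (adj G (ι₁ z) (ι₁ y) ∧ lookup W₁ (ι₁ y))
    step-transport z = cong₂ _∧_ (walk-transport s x z) (cong₂ _∧_ (sym (adj₁ z y)) (sym (W₁-ι y)))
    to-G : anyᶠ (λ z → Rₕ.walk s x z ∧ (adj H₁ z y ∧ lookup (restrict ι₁ W) y)) ≡ true →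
           anyᶠ (λ w → R₁.walk s (ι₁ x) w ∧ (adj G w (ι₁ y) ∧ lookup W₁ (ι₁ y))) ≡ true
    to-G e with anyᶠ-elim _ e
    ... | z , step = anyᶠ-intro _ (ι₁ z) (trans (sym (step-transport z)) step)
    from-G : anyᶠ (λ w → R₁.walk s (ι₁ x) w ∧ (adj G w (ι₁ y) ∧ lookup W₁ (ι₁ y))) ≡ true →
             anyᶠ (λ z → Rₕ.walk s x z ∧ (adj H₁ z y ∧ lookup (restrict ι₁ W) y)) ≡ true
    from-G e with anyᶠ-elim _ e
    ... | w , step with im-elim ι₁ w (proj₂ (∧-elim {lookup W w} (trans (sym (W₁-lookup w))
                          (R₁.walk-end s (ι₁ x) w (proj₁ (∧-elim {R₁.walk s (ι₁ x) w} step))))))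
    ...   | z , refl = anyᶠ-intro _ z (trans (step-transport z) step)

  ∼-transport : ∀ x y → Rₕ._∼_ x y ≡ ι₁ x ∼₁ ι₁ y
  ∼-transport x y = bool-ext (λ e → R₁.walk⇒∼ a₁ (ι₁ x) (ι₁ y) (trans (sym (walk-transport a₁ x y)) e))
                             (λ e → Rₕ.walk⇒∼ m x y (trans (walk-transport m x y) e))

  meets₁ : Fin m → Bool
  meets₁ u = anyᶠ (λ x → u ∼ ι₁ x)

  same-component : ∀ u x₀ x → u ∼ ι₁ x₀ ≡ true → u ∼ ι₁ x ≡ Rₕ._∼_ x x₀
  same-component u x₀ x ux₀ = bool-ext to-H from-H
    where
    to-H : u ∼ ι₁ x ≡ true → Rₕ._∼_ x x₀ ≡ true
    to-H ux = Rₕ.∼-sym x₀ x (trans (∼-transport x₀ x)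
      (connected-within (ι₁ x₀) (ι₁ x) (im-ι ι₁ x₀) (im-ι ι₁ x) (∼-trans (ι₁ x₀) u (ι₁ x) (∼-sym u (ι₁ x₀) ux₀) ux)))
    from-H : Rₕ._∼_ x x₀ ≡ true → u ∼ ι₁ x ≡ true
    from-H xx₀ = ∼-trans u (ι₁ x₀) (ι₁ x) ux₀
      (∼-sym (ι₁ x) (ι₁ x₀) (∼₁⇒∼ (ι₁ x) (ι₁ x₀) (trans (sym (∼-transport x x₀)) xx₀)))

  components-at : ∀ u → ∑[ x < a₁ ] (𝟙 (Rₕ.isLeast x) * 𝟙 (isLeast u ∧ u ∼ ι₁ x)) ≡ 𝟙 (isLeast u) * 𝟙 (meets₁ u)
  components-at u with isLeast u
  ... | false = ∑-zero a₁ (λ x → *-zeroʳ (𝟙 (Rₕ.isLeast x)))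
  ... | true with meets₁ u in meets
  ...   | false = ∑-zero a₁ (λ x → trans (cong (λ b → 𝟙 (Rₕ.isLeast x) * 𝟙 b) (anyᶠ-false _ meets x))
                                          (*-zeroʳ (𝟙 (Rₕ.isLeast x))))
  ...   | true with anyᶠ-elim _ meets
  ...     | x₀ , ux₀ = trans (sum-cong-≗ (λ x → trans (sym (𝟙-∧ (Rₕ.isLeast x) (u ∼ ι₁ x)))
                                       (cong (λ b → 𝟙 (Rₕ.isLeast x ∧ b)) (same-component u x₀ x ux₀))))
                         (Rₕ.one-least-per-component x₀ (trans (restrict-ι ι₁ W x₀) (∼-end u (ι₁ x₀) ux₀)))

  side-count : nc H₁ (restrict ι₁ W) ≡ ∑[ u < m ] (𝟙 (isLeast u) * 𝟙 (meets₁ u))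
  side-count = begin
    nc H₁ (restrict ι₁ W)
      ≡⟨ Rₕ.nc-as-# ⟩
    ∑[ x < a₁ ] 𝟙 (Rₕ.isLeast x)
      ≡⟨ sum-cong-≗ one-above ⟩
    ∑[ x < a₁ ] (𝟙 (Rₕ.isLeast x) * ∑[ u < m ] 𝟙 (isLeast u ∧ u ∼ ι₁ x))
      ≡⟨ sum-cong-≗ (λ x → *-distribˡ-sum (𝟙 (Rₕ.isLeast x)) (λ u → 𝟙 (isLeast u ∧ u ∼ ι₁ x))) ⟩
    ∑[ x < a₁ ] ∑[ u < m ] (𝟙 (Rₕ.isLeast x) * 𝟙 (isLeast u ∧ u ∼ ι₁ x))
      ≡⟨ ∑-comm (λ x u → 𝟙 (Rₕ.isLeast x) * 𝟙 (isLeast u ∧ u ∼ ι₁ x)) ⟩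
    ∑[ u < m ] ∑[ x < a₁ ] (𝟙 (Rₕ.isLeast x) * 𝟙 (isLeast u ∧ u ∼ ι₁ x))
      ≡⟨ sum-cong-≗ components-at ⟩
    ∑[ u < m ] (𝟙 (isLeast u) * 𝟙 (meets₁ u)) ∎
    where
    -- each component of H₁|_(restrict ι₁ W) lies in exactly one component of G|_W
    one-above : ∀ x → 𝟙 (Rₕ.isLeast x) ≡ 𝟙 (Rₕ.isLeast x) * ∑[ u < m ] 𝟙 (isLeast u ∧ u ∼ ι₁ x)
    one-above x with Rₕ.isLeast x in least
    ... | false = refl
    ... | true = sym (trans (+-identityʳ _) (one-least-per-component (ι₁ x)
                   (trans (sym (restrict-ι ι₁ W x)) (Rₕ.isLeast-∈ x least))))

-- The identity (★) for a fixed W: each component of G|_W meets im ι₁ or im ι₂, and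
-- meets both exactly when it contains a shared vertex; the shared vertices of W
-- all lie in one component.
module Components {m a₁ a₂ : ℕ} {G : Graph m} {H₁ : Graph a₁} {H₂ : Graph a₂}
                  (gl : Gluing G H₁ H₂) (W : Subset m) where

  open Gluing gl
  open Reach G W
  module S₁ = FirstSide gl W
  module S₂ = FirstSide (swap-sides gl) W
  open S₁ using (shared)

  meetsShared : Bool
  meetsShared = anyᶠ (λ f → shared f ∧ lookup W f)

  reachesShared : Fin m → Bool
  reachesShared u = anyᶠ (λ f → shared f ∧ u ∼ f)

  meets-a-side : ∀ u → lookup W u ≡ true → S₁.meets₁ u ∨ S₂.meets₁ u ≡ true
  meets-a-side u u∈W with ∨-elim {im ι₁ u} (covers u)
  ... | inj₁ u∈₁ with im-elim ι₁ u u∈₁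
  ...   | x , refl = ∨-introˡ _ (anyᶠ-intro _ x (∼-refl (ι₁ x) u∈W))
  meets-a-side u u∈W | inj₂ u∈₂ with im-elim ι₂ u u∈₂
  ...   | y , refl = ∨-introʳ (S₁.meets₁ (ι₂ y)) (anyᶠ-intro _ y (∼-refl (ι₂ y) u∈W))

  reachesShared-iff : ∀ u → reachesShared u ≡ S₁.meets₁ u ∧ S₂.meets₁ u
  reachesShared-iff u = bool-ext to-both from-both
    where
    to-both : reachesShared u ≡ true → S₁.meets₁ u ∧ S₂.meets₁ u ≡ true
    to-both e with anyᶠ-elim _ e
    ... | f , hit with ∧-elim {shared f} hit
    ...   | f∈ , uf with ∧-elim {im ι₁ f} f∈
    ...     | f∈₁ , f∈₂ with im-elim ι₁ f f∈₁ | im-elim ι₂ f f∈₂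
    ...       | x , refl | y , ι₂y≡f =
      ∧-intro (anyᶠ-intro _ x uf) (anyᶠ-intro _ y (subst (λ v → u ∼ v ≡ true) (sym ι₂y≡f) uf))
    from-both : S₁.meets₁ u ∧ S₂.meets₁ u ≡ true → reachesShared u ≡ true
    from-both e with ∧-elim {S₁.meets₁ u} e
    ... | m₁ , m₂ with anyᶠ-elim _ m₁ | anyᶠ-elim _ m₂
    ...   | x , ux | y , uy with im ι₁ (ι₂ y) in ι₂y∈₁
    ...     | true = anyᶠ-intro _ (ι₂ y) (∧-intro (∧-intro ι₂y∈₁ (im-ι ι₂ y)) uy)
    ...     | false with S₁.crosses-shared (ι₁ x) (ι₂ y) (im-ι ι₁ x) ι₂y∈₁
                        (∼-trans (ι₁ x) u (ι₂ y) (∼-sym u (ι₁ x) ux) uy)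
    ...       | f , f∈ , _ , xf = anyᶠ-intro _ f (∧-intro f∈ (∼-trans u (ι₁ x) f ux xf))

  per-vertex : ∀ u → 𝟙 (isLeast u) * 𝟙 (S₁.meets₁ u) + 𝟙 (isLeast u) * 𝟙 (S₂.meets₁ u)
                     ≡ 𝟙 (isLeast u) + 𝟙 (isLeast u ∧ reachesShared u)
  per-vertex u with isLeast u in least
  ... | false = refl
  ... | true = begin
    (𝟙 (S₁.meets₁ u) + 0) + (𝟙 (S₂.meets₁ u) + 0)
      ≡⟨ cong₂ _+_ (+-identityʳ (𝟙 (S₁.meets₁ u))) (+-identityʳ (𝟙 (S₂.meets₁ u))) ⟩
    𝟙 (S₁.meets₁ u) + 𝟙 (S₂.meets₁ u)
      ≡⟨ 𝟙-∨ (S₁.meets₁ u) (S₂.meets₁ u) (meets-a-side u (isLeast-∈ u least)) ⟩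
    1 + 𝟙 (S₁.meets₁ u ∧ S₂.meets₁ u)
      ≡⟨ cong (λ b → 1 + 𝟙 b) (reachesShared-iff u) ⟨
    1 + 𝟙 (reachesShared u) ∎

  shared-components : #[ (λ u → isLeast u ∧ reachesShared u) ] ≡ 𝟙 meetsShared
  shared-components with meetsShared in meets
  ... | true with anyᶠ-elim _ meets
  ...   | f₀ , hit with ∧-elim {shared f₀} hit
  ...     | f₀∈ , f₀∈W = trans (sum-cong-≗ (λ u → cong (λ b → 𝟙 (isLeast u ∧ b)) (bool-ext (to-f₀ u) (from-f₀ u))))
                               (one-least-per-component f₀ f₀∈W)
    where
    to-f₀ : ∀ u → reachesShared u ≡ true → u ∼ f₀ ≡ true
    to-f₀ u e with anyᶠ-elim _ e
    ... | f , hit' with ∧-elim {shared f} hit'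
    ...   | f∈ , uf = ∼-trans u f f₀ uf (S₁.shared-connected f f₀ f∈ f₀∈ (∼-end u f uf) f₀∈W)
    from-f₀ : ∀ u → u ∼ f₀ ≡ true → reachesShared u ≡ true
    from-f₀ u uf₀ = anyᶠ-intro _ f₀ (∧-intro f₀∈ uf₀)
  shared-components | false = ∑-zero m (λ u → cong 𝟙 (no-shared u))
    where
    no-shared : ∀ u → isLeast u ∧ reachesShared u ≡ false
    no-shared u with reachesShared u in e
    ... | false = ∧-zeroʳ (isLeast u)
    ... | true with anyᶠ-elim _ e
    ...   | f , hit with ∧-elim {shared f} hit
    ...     | f∈ , uf = ⊥-elim (true≢false (anyᶠ-intro _ f (∧-intro f∈ (∼-end u f uf))) meets)

  component-identity : nc G W + 𝟙 meetsShared ≡ nc H₁ (restrict ι₁ W) + nc H₂ (restrict ι₂ W)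
  component-identity = sym (begin
    nc H₁ (restrict ι₁ W) + nc H₂ (restrict ι₂ W)
      ≡⟨ cong₂ _+_ S₁.side-count S₂.side-count ⟩
    ∑[ u < m ] (𝟙 (isLeast u) * 𝟙 (S₁.meets₁ u)) + ∑[ u < m ] (𝟙 (isLeast u) * 𝟙 (S₂.meets₁ u))
      ≡⟨ ∑-distrib-+ (λ u → 𝟙 (isLeast u) * 𝟙 (S₁.meets₁ u)) (λ u → 𝟙 (isLeast u) * 𝟙 (S₂.meets₁ u)) ⟨
    ∑[ u < m ] (𝟙 (isLeast u) * 𝟙 (S₁.meets₁ u) + 𝟙 (isLeast u) * 𝟙 (S₂.meets₁ u))
      ≡⟨ sum-cong-≗ per-vertex ⟩
    ∑[ u < m ] (𝟙 (isLeast u) + 𝟙 (isLeast u ∧ reachesShared u))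
      ≡⟨ ∑-distrib-+ (𝟙 ∘ isLeast) (λ u → 𝟙 (isLeast u ∧ reachesShared u)) ⟩
    #[ isLeast ] + #[ (λ u → isLeast u ∧ reachesShared u) ]
      ≡⟨ cong₂ _+_ (sym nc-as-#) shared-components ⟩
    nc G W + 𝟙 meetsShared ∎)

∸-shift : ∀ a b m t → a + b ≡ m + t → m ∸ a ≡ b ∸ t
∸-shift a b m t a+b≡m+t = begin
  m ∸ a               ≡⟨ ℕₚ.[m+n]∸[m+o]≡n∸o t m a ⟨
  t + m ∸ (t + a)     ≡⟨ cong₂ _∸_ (+-comm t m) (+-comm t a) ⟩
  m + t ∸ (a + t)     ≡⟨ cong (_∸ (a + t)) a+b≡m+t ⟨
  a + b ∸ (a + t)     ≡⟨ ℕₚ.[m+n]∸[m+o]≡n∸o a b t ⟩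
  b ∸ t               ∎

module ConnectedSum {n₁ n₂ m t : ℕ} {G₁ : Graph n₁} {G₂ : Graph n₂} {G : Graph m}
                    (cs : IsConnectedSum t G₁ G₂ G) where

  open IsConnectedSum cs

  im-of : ∀ {a} (ι : Fin a → Fin m) {v} x → ι x ≡ v → im ι v ≡ true
  im-of ι x refl = im-ι ι x

  im₂-ι₁ : ∀ x → im ι₂ (ι₁ x) ≡ lookup F₁ x
  im₂-ι₁ x = bool-ext to-F₁ from-F₁
    where
    to-F₁ : im ι₂ (ι₁ x) ≡ true → lookup F₁ x ≡ true
    to-F₁ e with im-elim ι₂ (ι₁ x) e
    ... | y , ι₂y≡ι₁x = Vecₚ.[]=⇒lookup (inter⊆F₁ x y (sym ι₂y≡ι₁x))
    from-F₁ : lookup F₁ x ≡ true → im ι₂ (ι₁ x) ≡ true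
    from-F₁ e with F₁⊆V₂' x (Vecₚ.lookup⇒[]= x F₁ e)
    ... | y , ι₂y≡ι₁x = im-of ι₂ y ι₂y≡ι₁x

  shared-in-F₁ : ∀ v → im ι₁ v ∧ im ι₂ v ≡ true → ∃ λ x → ι₁ x ≡ v × x ∈ F₁
  shared-in-F₁ v e with ∧-elim {im ι₁ v} e
  ... | v∈₁ , v∈₂ with im-elim ι₁ v v∈₁ | im-elim ι₂ v v∈₂
  ...   | x , ι₁x≡v | y , ι₂y≡v = x , ι₁x≡v , inter⊆F₁ x y (trans ι₁x≡v (sym ι₂y≡v))

  in-F₂ : ∀ y x → ι₁ x ≡ ι₂ y → y ∈ F₂
  in-F₂ y x ι₁x≡ι₂y with F₁⊆σF₂ x (inter⊆F₁ x y ι₁x≡ι₂y)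
  ... | y' , y'∈F₂ , ι₂y'≡ι₁x = subst (_∈ F₂) (ι₂-inj y' y (trans ι₂y'≡ι₁x ι₁x≡ι₂y)) y'∈F₂

  -- An edge of G inside V₁ comes from G₁: an edge from σ(E₂) there joins two vertices
  -- of the clique F₁.
  adj-ι₁ : ∀ x y → adj G (ι₁ x) (ι₁ y) ≡ adj G₁ x y
  adj-ι₁ x y = bool-ext from-G (edges₁ x y)
    where
    from-G : adj G (ι₁ x) (ι₁ y) ≡ true → adj G₁ x y ≡ true
    from-G e with edges (ι₁ x) (ι₁ y) e
    ... | inj₁ (a , b , ι₁a≡ , ι₁b≡ , ab) =
      subst₂ (λ p q → adj G₁ p q ≡ true) (ι₁-inj a x ι₁a≡) (ι₁-inj b y ι₁b≡) ab
    ... | inj₂ (a , b , ι₂a≡ , ι₂b≡ , _) =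
      F₁-clique x y (inter⊆F₁ x a (sym ι₂a≡)) (inter⊆F₁ y b (sym ι₂b≡))
        (λ x≡y → true≢false (subst (λ z → adj G (ι₁ x) (ι₁ z) ≡ true) (sym x≡y) e) (adj-irrefl G (ι₁ x)))

  adj-ι₂ : ∀ x y → adj G (ι₂ x) (ι₂ y) ≡ adj G₂ x y
  adj-ι₂ x y = bool-ext from-G (edges₂ x y)
    where
    from-G : adj G (ι₂ x) (ι₂ y) ≡ true → adj G₂ x y ≡ true
    from-G e with edges (ι₂ x) (ι₂ y) e
    ... | inj₂ (a , b , ι₂a≡ , ι₂b≡ , ab) =
      subst₂ (λ p q → adj G₂ p q ≡ true) (ι₂-inj a x ι₂a≡) (ι₂-inj b y ι₂b≡) ab
    ... | inj₁ (a , b , ι₁a≡ , ι₁b≡ , _) =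
      F₂-clique x y (in-F₂ x a ι₁a≡) (in-F₂ y b ι₁b≡)
        (λ x≡y → true≢false (subst (λ z → adj G (ι₂ x) (ι₂ z) ≡ true) (sym x≡y) e) (adj-irrefl G (ι₂ x)))

  gluing : Gluing G G₁ G₂
  gluing = record
    { ι₁ = ι₁ ; ι₂ = ι₂ ; ι₁-inj = ι₁-inj ; ι₂-inj = ι₂-inj ; adj₁ = adj-ι₁ ; adj₂ = adj-ι₂
    ; covers = covers
    ; edge-inside = edge-inside
    ; shared-clique = clique
    }
    where
    covers : ∀ v → im ι₁ v ∨ im ι₂ v ≡ true
    covers v with cover v
    ... | inj₁ (x , ι₁x≡v) = ∨-introˡ _ (im-of ι₁ x ι₁x≡v)
    ... | inj₂ (y , ι₂y≡v) = ∨-introʳ (im ι₁ v) (im-of ι₂ y ι₂y≡v)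
    edge-inside : ∀ u v → adj G u v ≡ true → (im ι₁ u ∧ im ι₁ v ≡ true) ⊎ (im ι₂ u ∧ im ι₂ v ≡ true)
    edge-inside u v e with edges u v e
    ... | inj₁ (a , b , ι₁a≡u , ι₁b≡v , _) = inj₁ (∧-intro (im-of ι₁ a ι₁a≡u) (im-of ι₁ b ι₁b≡v))
    ... | inj₂ (a , b , ι₂a≡u , ι₂b≡v , _) = inj₂ (∧-intro (im-of ι₂ a ι₂a≡u) (im-of ι₂ b ι₂b≡v))
    clique : ∀ u v → im ι₁ u ∧ im ι₂ u ≡ true → im ι₁ v ∧ im ι₂ v ≡ true → u ≢ v →
      adj G u v ≡ true
    clique u v u∈ v∈ u≢v with shared-in-F₁ u u∈ | shared-in-F₁ v v∈
    ... | x , refl , x∈F₁ | y , refl , y∈F₁ = edges₁ x y (F₁-clique x y x∈F₁ y∈F₁ (u≢v ∘ cong ι₁))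

  shared : Fin m → Bool
  shared v = im ι₁ v ∧ im ι₂ v

  shared-count : #[ shared ] ≡ t
  shared-count = begin
    ∑[ v < m ] 𝟙 (im ι₁ v ∧ im ι₂ v)          ≡⟨ sum-cong-≗ (λ v → 𝟙-∧ (im ι₁ v) (im ι₂ v)) ⟩
    ∑[ v < m ] (𝟙 (im ι₁ v) * 𝟙 (im ι₂ v))    ≡⟨ Restriction.∑-image ι₁ ι₁-inj (𝟙 ∘ im ι₂) ⟩
    ∑[ x < n₁ ] 𝟙 (im ι₂ (ι₁ x))              ≡⟨ sum-cong-≗ (λ x → cong 𝟙 (im₂-ι₁ x)) ⟩
    #[ lookup F₁ ]                            ≡⟨ ∣∣-as-# F₁ ⟨
    ∣ F₁ ∣                                    ≡⟨ ∣F₁∣ ⟩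
    t                                         ∎

  vertex-count : n₁ + n₂ ≡ m + t
  vertex-count = begin
    n₁ + n₂                                        ≡⟨ cong₂ _+_ (Restriction.image-size ι₁ ι₁-inj)
                                                                 (Restriction.image-size ι₂ ι₂-inj) ⟨
    #[ im ι₁ ] + #[ im ι₂ ]                         ≡⟨ ∑-distrib-+ (𝟙 ∘ im ι₁) (𝟙 ∘ im ι₂) ⟨
    ∑[ v < m ] (𝟙 (im ι₁ v) + 𝟙 (im ι₂ v))          ≡⟨ sum-cong-≗ (λ v → 𝟙-∨ (im ι₁ v) (im ι₂ v) (Gluing.covers gluing v)) ⟩
    ∑[ v < m ] (1 + 𝟙 (shared v))                   ≡⟨ ∑-distrib-+ (λ _ → 1) (𝟙 ∘ shared) ⟩
    ∑[ v < m ] 1 + #[ shared ]                      ≡⟨ cong₂ _+_ (∑-ones m) shared-count ⟩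
    m + t                                           ∎

  unshared : Subset m
  unshared = tabulate (not ∘ shared)

  unshared-size : ∣ unshared ∣ ≡ n₁ + n₂ ∸ 2 * t
  unshared-size = begin
    ∣ unshared ∣               ≡⟨ complement-size shared shared-count ⟩
    m ∸ t                      ≡⟨ cong (_∸ t) (ℕₚ.m+n∸n≡m m t) ⟨
    m + t ∸ t ∸ t              ≡⟨ ℕₚ.∸-+-assoc (m + t) t t ⟩
    m + t ∸ (t + t)            ≡⟨ cong₂ (λ a b → a ∸ (t + b)) vertex-count (+-identityʳ t) ⟨
    n₁ + n₂ ∸ 2 * t            ∎

  avoids-shared : ∀ W → W ⊆ᵇ unshared ≡ not (Components.meetsShared gluing W)
  avoids-shared W with Components.meetsShared gluing W in meets
  ... | true with anyᶠ-elim _ meets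
  ...   | f , hit with ∧-elim {shared f} hit
  ...     | f∈ , f∈W = not-true⇒false (λ W⊆ → true≢false f∈
                         (not≡true (trans (sym (Vecₚ.lookup∘tabulate (not ∘ shared) f)) (⊆ᵇ-elim W unshared W⊆ f f∈W))))
  avoids-shared W | false = ⊆ᵇ-intro W unshared (λ v v∈W → trans (Vecₚ.lookup∘tabulate (not ∘ shared) v)
    (cong not (not-true⇒false (λ v∈ → true≢false (anyᶠ-intro _ v (∧-intro v∈ v∈W)) meets))))

  -- Summing (★) over all k-subsets W of V; the terms [W ∩ F = ∅] add up to C(m − t, k).
  summed-identity : ∀ k → c k G + (n₁ + n₂ ∸ t) C k
    ≡ ((λ i → c i G₁) ⋆ ((n₂ ∸ t) C_)) k + ((λ i → c i G₂) ⋆ ((n₁ ∸ t) C_)) k + (n₁ + n₂ ∸ 2 * t) C k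
  summed-identity k = begin
    c k G + (n₁ + n₂ ∸ t) C k
      ≡⟨ cong₂ _+_ (c-as-∑ˢ k G) (trans (cong (_C k) m≡) (sym (k-subsets-count m k))) ⟩
    ∑ˢ m (λ W → [k] W * nc G W) + ∑ˢ m [k]
      ≡⟨ ∑ˢ-+ m _ _ ⟨
    ∑ˢ m (λ W → [k] W * nc G W + [k] W)
      ≡⟨ ∑ˢ-cong m (λ W → 𝟙-split ([k] W) (nc G W) (meetsShared W)) ⟩
    ∑ˢ m (λ W → [k] W * (nc G W + 𝟙 (meetsShared W)) + [k] W * 𝟙 (not (meetsShared W)))
      ≡⟨ ∑ˢ-+ m _ _ ⟩
    ∑ˢ m (λ W → [k] W * (nc G W + 𝟙 (meetsShared W))) + ∑ˢ m (λ W → [k] W * 𝟙 (not (meetsShared W)))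
      ≡⟨ cong₂ _+_ (∑ˢ-cong m (λ W → cong ([k] W *_) (component-identity W)))
                   (∑ˢ-cong m (λ W → cong (λ b → [k] W * 𝟙 b) (sym (avoids-shared W)))) ⟩
    ∑ˢ m (λ W → [k] W * (nc G₁ (restrict ι₁ W) + nc G₂ (restrict ι₂ W))) + ∑ˢ m (λ W → [k] W * 𝟙 (W ⊆ᵇ unshared))
      ≡⟨ cong₂ _+_ (trans (∑ˢ-cong m (λ W → ℕₚ.*-distribˡ-+ ([k] W) _ _)) (∑ˢ-+ m _ _)) (subsets-count unshared k) ⟩
    ∑ˢ m (λ W → [k] W * nc G₁ (restrict ι₁ W)) + ∑ˢ m (λ W → [k] W * nc G₂ (restrict ι₂ W)) + ∣ unshared ∣ C k
      ≡⟨ cong₂ _+_ (cong₂ _+_ (Restriction.c-restriction-sum ι₁ ι₁-inj G₁ k)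
                              (Restriction.c-restriction-sum ι₂ ι₂-inj G₂ k))
                   (cong (_C k) unshared-size) ⟩
    ((λ i → c i G₁) ⋆ ((m ∸ n₁) C_)) k + ((λ i → c i G₂) ⋆ ((m ∸ n₂) C_)) k + (n₁ + n₂ ∸ 2 * t) C k
      ≡⟨ cong₂ (λ d₁ d₂ → ((λ i → c i G₁) ⋆ (d₁ C_)) k + ((λ i → c i G₂) ⋆ (d₂ C_)) k + (n₁ + n₂ ∸ 2 * t) C k)
               (∸-shift n₁ n₂ m t vertex-count) (∸-shift n₂ n₁ m t (trans (+-comm n₂ n₁) vertex-count)) ⟩
    ((λ i → c i G₁) ⋆ ((n₂ ∸ t) C_)) k + ((λ i → c i G₂) ⋆ ((n₁ ∸ t) C_)) k + (n₁ + n₂ ∸ 2 * t) C k ∎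
    where
    open Components gluing using (meetsShared; component-identity)
    [k] : Subset m → ℕ
    [k] W = 𝟙 (∣ W ∣ ≡ᵇ k)
    m≡ : n₁ + n₂ ∸ t ≡ m
    m≡ = trans (cong (_∸ t) vertex-count) (ℕₚ.m+n∸n≡m m t)

-- Lemma 3.1.
lemma3p1 : ∀ {n₁ n₂ m : ℕ} (G₁ : Graph n₁) (G₂ : Graph n₂) (G : Graph m) (t : ℕ) →
    1 ≤ t → IsConnectedSum t G₁ G₂ G → (k : ℕ) →
    c k G + ((n₁ + n₂ ∸ t) C k)
      ≡ sum (map (λ i → c i G₁ * ((n₂ ∸ t) C (k ∸ i)) + c i G₂ * ((n₁ ∸ t) C (k ∸ i)))
                 (upTo (suc k)))
        + ((n₁ + n₂ ∸ 2 * t) C k)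
lemma3p1 {n₁} {n₂} G₁ G₂ G t _ cs k = begin
  c k G + (n₁ + n₂ ∸ t) C k
    ≡⟨ ConnectedSum.summed-identity cs k ⟩
  ((λ i → c i G₁) ⋆ ((n₂ ∸ t) C_)) k + ((λ i → c i G₂) ⋆ ((n₁ ∸ t) C_)) k + (n₁ + n₂ ∸ 2 * t) C k
    ≡⟨ cong (_+ (n₁ + n₂ ∸ 2 * t) C k)
            (⋆-pair-as-sum (λ i → c i G₁) ((n₂ ∸ t) C_) (λ i → c i G₂) ((n₁ ∸ t) C_) k) ⟩
  sum (map (λ i → c i G₁ * ((n₂ ∸ t) C (k ∸ i)) + c i G₂ * ((n₁ ∸ t) C (k ∸ i))) (upTo (suc k)))
    + (n₁ + n₂ ∸ 2 * t) C k ∎
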